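{- Let $k\ge 2$ and for $n\ge0$ let $a(n)$ be the number of alternating permutations of length $n$ avoiding both $1\mbox{ - }3\mbox{ - }2$ and $1\mbox{ - }2\mbox{ - }\cdots\mbox{ - }k$. Then $$\sum_{n\ge0}a(n)x^n=\frac{(1+x)\,U_{k-2}\!\left(\frac{1}{2x}\right)}{x\,U_{k-1}\!\left(\frac{1}{2x}\right)}=(1+x)R_{k-1}(x^2),$$ where $R_m(x)=\dfrac{U_{m-1}\!\left(\frac{1}{2\sqrt x}\right)}{\sqrt{x}\,U_m\!\left(\frac{1}{2\sqrt x}\right)}$.
   Context: A permutation of length $n$ is a word $\pi_1\cdots\pi_n$ containing each of $1,\dots,n$ exactly once. A classical pattern $\tau$ (written with dashes, e.g. $1\mbox{ - }3\mbox{ - }2$ is $132$, $1\mbox{ - }2\mbox{ - }\cdots\mbox{ - }k$ is $12\cdots k$) occurs in $\pi$ if some subsequence of $\pi$ is order-isomorphic to $\tau$; otherwise $\pi$ avoids $\tau$. A permutation is alternating if $\pi_1<\pi_2>\pi_3<\pi_4>\cdots$, i.e. $\pi_{2j-1}<\pi_{2j}$ and $\pi_{2j}>\pi_{2j+1}$ whenever the indices are at most $n$; the empty permutation and the permutation of length $1$ are alternating. $U_r$ is the Chebyshev polynomial of the second kind: $U_r(\cos\theta)=\sin((r+1)\theta)/\sin\theta$, so $U_0=1$, $U_1(t)=2t$, $U_r(t)=2tU_{r-1}(t)-U_{r-2}(t)$. -}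

module Defs where

open import Data.Nat as ℕ using (ℕ; zero; suc; _<_; _>_; _∸_; _≤ᵇ_)
open import Data.Integer as ℤ using (ℤ; +_; _-_)
open import Data.Fin using (Fin; cast)
open import Data.List using (List; []; _∷_; length; lookup; map; upTo)
open import Data.List.Relation.Binary.Sublist.Propositional using (_⊆_)
open import Data.List.Relation.Binary.Permutation.Propositional using (_↭_)
open import Data.List.Membership.Propositional using (_∈_)
open import Data.List.Relation.Unary.Unique.Propositional using (Unique)
open import Data.Product using (Σ; _×_; ∃)
open import Data.Unit using (⊤)
open import Data.Bool using (if_then_else_)
open import Function.Bundles using (_⇔_)
open import Relation.Binary.PropositionalEquality using (_≡_)
open import Relation.Nullary using (¬_)

IsPerm : ℕ → List ℕ → Set
IsPerm n w = w ↭ map suc (upTo n)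

mutual
  AltUp : List ℕ → Set
  AltUp [] = ⊤
  AltUp (x ∷ []) = ⊤
  AltUp (x ∷ y ∷ r) = x < y × AltDown (y ∷ r)

  AltDown : List ℕ → Set
  AltDown [] = ⊤
  AltDown (x ∷ []) = ⊤
  AltDown (x ∷ y ∷ r) = x > y × AltUp (y ∷ r)

Alternating : List ℕ → Set
Alternating = AltUp

OrderIso : List ℕ → List ℕ → Set
OrderIso u τ = Σ (length u ≡ length τ) λ eq →
  (i j : Fin (length u)) →
    (lookup u i < lookup u j) ⇔ (lookup τ (cast eq i) < lookup τ (cast eq j))

Occurs : List ℕ → List ℕ → Set
Occurs τ π = ∃ λ u → (u ⊆ π) × OrderIso u τ

Avoids : List ℕ → List ℕ → Set
Avoids τ π = ¬ Occurs τ π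

p132 : List ℕ
p132 = 1 ∷ 3 ∷ 2 ∷ []

inc : ℕ → List ℕ
inc k = map suc (upTo k)

Counted : ℕ → ℕ → List ℕ → Set
Counted k n w = IsPerm n w × Alternating w × Avoids p132 w × Avoids (inc k) w

IsCount : ℕ → ℕ → ℕ → Set
IsCount k n c = Σ (List (List ℕ)) λ L →
  (length L ≡ c) × Unique L × ((w : List ℕ) → (w ∈ L) ⇔ Counted k n w)

-- Chebyshev polynomials of the second kind, as coefficient functions:
-- U r j = coefficient of t^j in U_r(t).

U : ℕ → ℕ → ℤ
U zero zero = + 1
U zero (suc j) = + 0
U (suc zero) zero = + 0
U (suc zero) (suc zero) = + 2
U (suc zero) (suc (suc j)) = + 0
U (suc (suc r)) zero = + 0 - U r zero
U (suc (suc r)) (suc j) = (+ 2 ℤ.* U (suc r) j) - U r (suc j)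

-- Coefficient of x^m in the polynomial 2^d x^d U_d(1/(2x))
--   = Σ_j U d j · 2^(d-j) x^(d-j).
Uhat : ℕ → ℕ → ℤ
Uhat d m = if m ≤ᵇ d then U d (d ∸ m) ℤ.* (+ (2 ℕ.^ m)) else + 0

sumTo : ℕ → (ℕ → ℤ) → ℤ
sumTo zero f = f zero
sumTo (suc n) f = sumTo n f ℤ.+ f (suc n)

_⋆_ : (ℕ → ℤ) → (ℕ → ℤ) → (ℕ → ℤ)
(f ⋆ g) n = sumTo n (λ i → f i ℤ.* g (n ∸ i))

onePlusX : (ℕ → ℤ) → (ℕ → ℤ)
onePlusX f zero = f zero
onePlusX f (suc n) = f (suc n) ℤ.+ f n

module Submission where

-- Split an alternating permutation avoiding 132 at its maximum n.  Avoiding 132 forces every entry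
-- left of n to exceed every entry right of n, and alternation forces the left block to have odd
-- length unless the permutation is just n.  So if C_k is the generating function for pattern length k
-- and O_k its odd part, then C_{k+1} = 1 + x(1 + O_k C_{k+1}) for k ≥ 1, and taking odd parts,
-- O_{k+1} = x(1 + O_k O_{k+1}) with O_1 = 0.  The polynomials Û_d(x) = (2x)^d U_d(1/(2x)) satisfy
-- Û_{d+2} = 2Û_{d+1} − 4x²Û_d, and these two relations give, by induction on t,
-- O_{t+1} Û_t = 2x Û_{t−1} and then C_{t+2} Û_{t+1} = 2(1 + x) Û_t.

open import Defs

module PowerSeries where

  open import Data.Nat as ℕ using (ℕ; zero; suc; _∸_; _≤_; _<_; _^_; z≤n; s≤s; _≤?_)
  import Data.Nat.Properties as ℕP
  open import Data.Integer using (ℤ; +_; 0ℤ; 1ℤ; _+_; _*_; _-_; -_)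
  import Data.Integer.Properties as ℤP
  open import Data.Integer.Tactic.RingSolver using (solve-∀)
  open import Data.Bool using (Bool; true; false; T; not; _xor_; if_then_else_)
  import Data.Bool.Properties as BoolP
  open import Relation.Nullary using (yes; no)
  open import Relation.Binary.PropositionalEquality
    using (_≡_; _≗_; refl; sym; trans; cong; cong₂; subst; module ≡-Reasoning)
  open ≡-Reasoning

  Series : Set
  Series = ℕ → ℤ

  𝟘 : Series
  𝟘 _ = 0ℤ

  one : Series
  one zero = 1ℤ
  one (suc _) = 0ℤ

  X : Series → Series
  X f zero = 0ℤ
  X f (suc n) = f n

  infixl 6 _⊕_
  infixl 7 _·_

  _⊕_ : Series → Series → Series
  (f ⊕ g) n = f n + g n

  _·_ : ℤ → Series → Series
  (c · f) n = c * f n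

  sumTo-cong : ∀ n {f g : Series} → (∀ i → i ≤ n → f i ≡ g i) → sumTo n f ≡ sumTo n g
  sumTo-cong zero f≡g = f≡g 0 z≤n
  sumTo-cong (suc n) f≡g =
    cong₂ _+_ (sumTo-cong n (λ i i≤n → f≡g i (ℕP.m≤n⇒m≤1+n i≤n))) (f≡g (suc n) ℕP.≤-refl)

  sumTo-zero : ∀ n {f : Series} → f ≗ 𝟘 → sumTo n f ≡ 0ℤ
  sumTo-zero zero f≗0 = f≗0 0
  sumTo-zero (suc n) f≗0 = cong₂ _+_ (sumTo-zero n f≗0) (f≗0 (suc n))

  sumTo-⊕ : ∀ n (f g : Series) → sumTo n (f ⊕ g) ≡ sumTo n f + sumTo n g
  sumTo-⊕ zero f g = refl
  sumTo-⊕ (suc n) f g = begin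
    sumTo n (f ⊕ g) + (f (suc n) + g (suc n))       ≡⟨ cong (_+ (f (suc n) + g (suc n))) (sumTo-⊕ n f g) ⟩
    sumTo n f + sumTo n g + (f (suc n) + g (suc n)) ≡⟨ interchange (sumTo n f) (sumTo n g) (f (suc n)) (g (suc n)) ⟩
    sumTo n f + f (suc n) + (sumTo n g + g (suc n)) ∎
    where
    interchange : ∀ a b c d → a + b + (c + d) ≡ a + c + (b + d)
    interchange = solve-∀

  sumTo-· : ∀ n c (f : Series) → sumTo n (c · f) ≡ c * sumTo n f
  sumTo-· zero c f = refl
  sumTo-· (suc n) c f = begin
    sumTo n (c · f) + c * f (suc n) ≡⟨ cong (_+ c * f (suc n)) (sumTo-· n c f) ⟩
    c * sumTo n f + c * f (suc n)   ≡⟨ ℤP.*-distribˡ-+ c (sumTo n f) (f (suc n)) ⟨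
    c * (sumTo n f + f (suc n))     ∎

  tail : Series → Series
  tail f n = f (suc n)

  sumTo-suc : ∀ n (f : Series) → sumTo (suc n) f ≡ f 0 + sumTo n (tail f)
  sumTo-suc zero f = refl
  sumTo-suc (suc n) f = begin
    sumTo (suc n) f + f (suc (suc n))        ≡⟨ cong (_+ f (suc (suc n))) (sumTo-suc n f) ⟩
    f 0 + sumTo n (tail f) + f (suc (suc n)) ≡⟨ ℤP.+-assoc (f 0) _ _ ⟩
    f 0 + sumTo (suc n) (tail f)             ∎

  ⋆-congˡ : ∀ {f f′ : Series} (g : Series) → f ≗ f′ → f ⋆ g ≗ f′ ⋆ g
  ⋆-congˡ g f≗f′ n = sumTo-cong n (λ i _ → cong (_* g (n ∸ i)) (f≗f′ i))

  ⋆-congʳ : ∀ (f : Series) {g g′ : Series} → g ≗ g′ → f ⋆ g ≗ f ⋆ g′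
  ⋆-congʳ f g≗g′ n = sumTo-cong n (λ i _ → cong (f i *_) (g≗g′ (n ∸ i)))

  ⋆-sucˡ : ∀ (f g : Series) n → (f ⋆ g) (suc n) ≡ f 0 * g (suc n) + (tail f ⋆ g) n
  ⋆-sucˡ f g n = sumTo-suc n _

  ⋆-sucʳ : ∀ (f g : Series) n → (f ⋆ g) (suc n) ≡ (f ⋆ tail g) n + f (suc n) * g 0
  ⋆-sucʳ f g n = cong₂ _+_
    (sumTo-cong n (λ i i≤n → cong (λ j → f i * g j) (ℕP.+-∸-assoc 1 i≤n)))
    (cong (λ j → f (suc n) * g j) (ℕP.n∸n≡0 n))

  ⋆-comm : ∀ (f g : Series) → f ⋆ g ≗ g ⋆ f
  ⋆-comm f g zero = ℤP.*-comm (f 0) (g 0)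
  ⋆-comm f g (suc n) = begin
    (f ⋆ g) (suc n)                    ≡⟨ ⋆-sucˡ f g n ⟩
    f 0 * g (suc n) + (tail f ⋆ g) n   ≡⟨ cong₂ _+_ (ℤP.*-comm (f 0) (g (suc n))) (⋆-comm (tail f) g n) ⟩
    g (suc n) * f 0 + (g ⋆ tail f) n   ≡⟨ ℤP.+-comm (g (suc n) * f 0) _ ⟩
    (g ⋆ tail f) n + g (suc n) * f 0   ≡⟨ ⋆-sucʳ g f n ⟨
    (g ⋆ f) (suc n)                    ∎

  ⋆-distribʳ-⊕ : ∀ (h f g : Series) → (f ⊕ g) ⋆ h ≗ f ⋆ h ⊕ g ⋆ h
  ⋆-distribʳ-⊕ h f g n =
    trans (sumTo-cong n (λ i _ → ℤP.*-distribʳ-+ (h (n ∸ i)) (f i) (g i))) (sumTo-⊕ n _ _)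

  ⋆-distribˡ-⊕ : ∀ (f g h : Series) → f ⋆ (g ⊕ h) ≗ f ⋆ g ⊕ f ⋆ h
  ⋆-distribˡ-⊕ f g h n = begin
    (f ⋆ (g ⊕ h)) n            ≡⟨ ⋆-comm f (g ⊕ h) n ⟩
    ((g ⊕ h) ⋆ f) n            ≡⟨ ⋆-distribʳ-⊕ f g h n ⟩
    (g ⋆ f) n + (h ⋆ f) n      ≡⟨ cong₂ _+_ (⋆-comm g f n) (⋆-comm h f n) ⟩
    (f ⋆ g) n + (f ⋆ h) n      ∎

  ⋆-·ˡ : ∀ c (f g : Series) → (c · f) ⋆ g ≗ c · (f ⋆ g)
  ⋆-·ˡ c f g n = trans (sumTo-cong n (λ i _ → ℤP.*-assoc c (f i) (g (n ∸ i)))) (sumTo-· n c _)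

  ⋆-·ʳ : ∀ c (f g : Series) → f ⋆ (c · g) ≗ c · (f ⋆ g)
  ⋆-·ʳ c f g n = begin
    (f ⋆ (c · g)) n  ≡⟨ ⋆-comm f (c · g) n ⟩
    ((c · g) ⋆ f) n  ≡⟨ ⋆-·ˡ c g f n ⟩
    c * (g ⋆ f) n    ≡⟨ cong (c *_) (⋆-comm g f n) ⟩
    c * (f ⋆ g) n    ∎

  ⋆-assoc : ∀ (f g h : Series) → (f ⋆ g) ⋆ h ≗ f ⋆ (g ⋆ h)
  ⋆-assoc f g h zero = ℤP.*-assoc (f 0) (g 0) (h 0)
  ⋆-assoc f g h (suc n) = begin
    ((f ⋆ g) ⋆ h) (suc n)
      ≡⟨ ⋆-sucˡ (f ⋆ g) h n ⟩
    f 0 * g 0 * h (suc n) + (tail (f ⋆ g) ⋆ h) n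
      ≡⟨ cong (_+_ (f 0 * g 0 * h (suc n))) (⋆-congˡ h (⋆-sucˡ f g) n) ⟩
    f 0 * g 0 * h (suc n) + ((f 0 · tail g ⊕ tail f ⋆ g) ⋆ h) n
      ≡⟨ cong (_+_ (f 0 * g 0 * h (suc n))) (⋆-distribʳ-⊕ h (f 0 · tail g) (tail f ⋆ g) n) ⟩
    f 0 * g 0 * h (suc n) + (((f 0 · tail g) ⋆ h) n + ((tail f ⋆ g) ⋆ h) n)
      ≡⟨ cong₂ (λ a b → f 0 * g 0 * h (suc n) + (a + b)) (⋆-·ˡ (f 0) (tail g) h n) (⋆-assoc (tail f) g h n) ⟩
    f 0 * g 0 * h (suc n) + (f 0 * (tail g ⋆ h) n + (tail f ⋆ (g ⋆ h)) n)
      ≡⟨ regroup (f 0) (g 0) (h (suc n)) _ _ ⟩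
    f 0 * (g 0 * h (suc n) + (tail g ⋆ h) n) + (tail f ⋆ (g ⋆ h)) n
      ≡⟨ cong (λ a → f 0 * a + (tail f ⋆ (g ⋆ h)) n) (⋆-sucˡ g h n) ⟨
    f 0 * (g ⋆ h) (suc n) + (tail f ⋆ (g ⋆ h)) n
      ≡⟨ ⋆-sucˡ f (g ⋆ h) n ⟨
    (f ⋆ (g ⋆ h)) (suc n) ∎
    where
    regroup : ∀ a b c d e → a * b * c + (a * d + e) ≡ a * (b * c + d) + e
    regroup = solve-∀

  one-⋆ : ∀ (f : Series) → one ⋆ f ≗ f
  one-⋆ f zero = ℤP.*-identityˡ (f 0)
  one-⋆ f (suc n) = begin
    (one ⋆ f) (suc n)               ≡⟨ ⋆-sucˡ one f n ⟩
    1ℤ * f (suc n) + (𝟘 ⋆ f) n      ≡⟨ cong₂ _+_ (ℤP.*-identityˡ (f (suc n))) (sumTo-zero n (λ _ → refl)) ⟩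
    f (suc n) + 0ℤ                  ≡⟨ ℤP.+-identityʳ _ ⟩
    f (suc n)                       ∎

  X-⋆ : ∀ (f g : Series) → X f ⋆ g ≗ X (f ⋆ g)
  X-⋆ f g zero = refl
  X-⋆ f g (suc n) = trans (⋆-sucˡ (X f) g n) (ℤP.+-identityˡ _)

  ⋆-X : ∀ (f g : Series) → f ⋆ X g ≗ X (f ⋆ g)
  ⋆-X f g zero = trans (⋆-comm f (X g) 0) (X-⋆ g f 0)
  ⋆-X f g (suc n) = trans (⋆-comm f (X g) (suc n)) (trans (X-⋆ g f (suc n)) (⋆-comm g f n))

  X-cong : ∀ {f g : Series} → f ≗ g → X f ≗ X g
  X-cong f≗g zero = refl
  X-cong f≗g (suc n) = f≗g n

  onePlusX≗ : ∀ f → onePlusX f ≗ f ⊕ X f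
  onePlusX≗ f zero = sym (ℤP.+-identityʳ (f 0))
  onePlusX≗ f (suc n) = refl

  X-⊕ : ∀ (f g : Series) → X (f ⊕ g) ≗ X f ⊕ X g
  X-⊕ f g zero = refl
  X-⊕ f g (suc n) = refl

  U-vanishes : ∀ {r j} → r < j → U r j ≡ 0ℤ
  U-vanishes {zero} {suc j} _ = refl
  U-vanishes {suc zero} {suc zero} (s≤s ())
  U-vanishes {suc zero} {suc (suc j)} _ = refl
  U-vanishes {suc (suc r)} {suc j} (s≤s r<j) =
    cong₂ (λ a b → + 2 * a - b) (U-vanishes r<j) (U-vanishes (ℕP.m<n⇒m<1+n (ℕP.<-trans (ℕP.n<1+n r) r<j)))

  Uhat-coeff : ∀ {d m} e → e ℕ.+ m ≡ d → Uhat d m ≡ U d e * + (2 ^ m)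
  Uhat-coeff {d} {m} e e+m≡d with m ℕ.≤ᵇ d in m≤ᵇd
  ... | true = cong (λ j → U d j * + (2 ^ m)) d∸m≡e
    where
    d∸m≡e : d ∸ m ≡ e
    d∸m≡e = trans (cong (_∸ m) (sym e+m≡d)) (ℕP.m+n∸n≡m e m)
  ... | false with () ← subst T m≤ᵇd (ℕP.≤⇒≤ᵇ (subst (m ≤_) e+m≡d (ℕP.m≤n+m m e)))

  Uhat-vanishes : ∀ {d m} → d < m → Uhat d m ≡ 0ℤ
  Uhat-vanishes {d} {m} d<m with m ℕ.≤ᵇ d in m≤ᵇd
  ... | false = refl
  ... | true with () ← ℕP.<⇒≱ d<m (ℕP.≤ᵇ⇒≤ m d (subst T (sym m≤ᵇd) _))

  pow2-suc-suc : ∀ m → + (2 ^ suc (suc m)) ≡ + 4 * + (2 ^ m)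
  pow2-suc-suc m = trans (cong +_ (sym (ℕP.*-assoc 2 2 (2 ^ m)))) (ℤP.pos-* 4 (2 ^ m))

  X²-Uhat : ∀ {d m} e → e ℕ.+ m ≡ suc (suc d) → + 4 * X (X (Uhat d)) m ≡ U d e * + (2 ^ m)
  X²-Uhat {d} {zero} e e+0≡d+2 =
    sym (cong (_* + 1) (U-vanishes (subst (d <_) (trans (sym e+0≡d+2) (ℕP.+-identityʳ e)) d<d+2)))
    where
    d<d+2 : d < suc (suc d)
    d<d+2 = ℕP.m<n⇒m<1+n (ℕP.n<1+n d)
  X²-Uhat {d} {suc zero} e e+1≡d+2 =
    sym (cong (_* + 2) (U-vanishes (subst (d <_) (ℕP.suc-injective (trans (sym e+1≡d+2) (ℕP.+-comm e 1))) (ℕP.n<1+n d))))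
  X²-Uhat {d} {suc (suc m)} e e+m+2≡d+2 = begin
    + 4 * Uhat d m                  ≡⟨ cong (+ 4 *_) (Uhat-coeff e e+m≡d) ⟩
    + 4 * (U d e * + (2 ^ m))       ≡⟨ move (U d e) (+ (2 ^ m)) ⟩
    U d e * (+ 4 * + (2 ^ m))       ≡⟨ cong (U d e *_) (pow2-suc-suc m) ⟨
    U d e * + (2 ^ suc (suc m))     ∎
    where
    e+m≡d : e ℕ.+ m ≡ d
    e+m≡d = ℕP.suc-injective (ℕP.suc-injective
      (trans (sym (trans (ℕP.+-suc e (suc m)) (cong suc (ℕP.+-suc e m)))) e+m+2≡d+2))
    move : ∀ a p → + 4 * (a * p) ≡ a * (+ 4 * p)
    move = solve-∀

  -- Û_d = (2x)^d U_d(1/(2x)) turns U_{d+2}(t) = 2t U_{d+1}(t) − U_d(t) into this recurrence.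
  Uhat-recurrence : ∀ d → Uhat (suc (suc d)) ≗ + 2 · Uhat (suc d) ⊕ - + 4 · X (X (Uhat d))
  Uhat-recurrence d m with m ≤? suc (suc d)
  ... | yes m≤d+2 = within (suc (suc d) ∸ m) (ℕP.m∸n+n≡m m≤d+2)
    where
    subtract : ∀ e → e ℕ.+ m ≡ suc (suc d) →
      + 2 * Uhat (suc d) m + - + 4 * X (X (Uhat d)) m ≡ + 2 * Uhat (suc d) m - U d e * + (2 ^ m)
    subtract e eq = cong (_+_ (+ 2 * Uhat (suc d) m))
      (trans (sym (ℤP.neg-distribˡ-* (+ 4) _)) (cong -_ (X²-Uhat e eq)))
    within : ∀ e → e ℕ.+ m ≡ suc (suc d) →
      Uhat (suc (suc d)) m ≡ + 2 * Uhat (suc d) m + - + 4 * X (X (Uhat d)) m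
    within zero m≡d+2 = begin
      Uhat (suc (suc d)) m                 ≡⟨ Uhat-coeff 0 m≡d+2 ⟩
      (0ℤ - U d 0) * + (2 ^ m)             ≡⟨ ring (U d 0) (+ (2 ^ m)) ⟩
      + 2 * 0ℤ - U d 0 * + (2 ^ m)         ≡⟨ cong (λ a → + 2 * a - U d 0 * + (2 ^ m)) (Uhat-vanishes d+1<m) ⟨
      + 2 * Uhat (suc d) m - U d 0 * + (2 ^ m) ≡⟨ subtract 0 m≡d+2 ⟨
      + 2 * Uhat (suc d) m + - + 4 * X (X (Uhat d)) m ∎
      where
      d+1<m : suc d < m
      d+1<m = subst (suc d <_) (sym m≡d+2) ℕP.≤-refl
      ring : ∀ u p → (0ℤ - u) * p ≡ + 2 * 0ℤ - u * p
      ring = solve-∀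
    within (suc j) j+1+m≡d+2 = begin
      Uhat (suc (suc d)) m                                    ≡⟨ Uhat-coeff (suc j) j+1+m≡d+2 ⟩
      (+ 2 * U (suc d) j - U d (suc j)) * + (2 ^ m)           ≡⟨ ring (U (suc d) j) (U d (suc j)) (+ (2 ^ m)) ⟩
      + 2 * (U (suc d) j * + (2 ^ m)) - U d (suc j) * + (2 ^ m)
        ≡⟨ cong (λ a → + 2 * a - U d (suc j) * + (2 ^ m)) (Uhat-coeff j (ℕP.suc-injective j+1+m≡d+2)) ⟨
      + 2 * Uhat (suc d) m - U d (suc j) * + (2 ^ m)          ≡⟨ subtract (suc j) j+1+m≡d+2 ⟨
      + 2 * Uhat (suc d) m + - + 4 * X (X (Uhat d)) m         ∎
      where
      ring : ∀ a b p → (+ 2 * a - b) * p ≡ + 2 * (a * p) - b * p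
      ring = solve-∀
  ... | no m≰d+2 = outside (ℕP.≰⇒> m≰d+2)
    where
    outside : ∀ {m} → suc (suc d) < m →
      Uhat (suc (suc d)) m ≡ + 2 * Uhat (suc d) m + - + 4 * X (X (Uhat d)) m
    outside {suc (suc (suc m))} d+2<m@(s≤s (s≤s (s≤s d≤m))) rewrite
      Uhat-vanishes d+2<m | Uhat-vanishes (ℕP.m<n⇒m<1+n (s≤s (s≤s d≤m))) | Uhat-vanishes {d} (s≤s d≤m) = refl

  Uprev : ℕ → Series
  Uprev zero = 𝟘
  Uprev (suc d) = Uhat d

  Uhat-step : ∀ d → Uhat (suc d) ≗ + 2 · Uhat d ⊕ - + 4 · X (X (Uprev d))
  Uhat-step zero zero = refl
  Uhat-step zero (suc zero) = refl
  Uhat-step zero (suc (suc m)) = refl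
  Uhat-step (suc d) = Uhat-recurrence d

  𝟘-⋆ : ∀ (f : Series) → 𝟘 ⋆ f ≗ 𝟘
  𝟘-⋆ f n = sumTo-zero n (λ _ → refl)

  X-· : ∀ c (f : Series) → c · X f ≗ X (c · f)
  X-· c f zero = ℤP.*-zeroʳ c
  X-· c f (suc n) = refl

  -- S W = 2 S V − 4x² S P, and 2x² S P = x S Q V cancels the term x Q S V of S V = B V + x(V + Q S V).
  denominator-step : ∀ {S B Q V P W : Series} →
    S ≗ B ⊕ X (one ⊕ Q ⋆ S) → Q ⋆ V ≗ + 2 · X P → W ≗ + 2 · V ⊕ - + 4 · X (X P) →
    S ⋆ W ≗ + 2 · (B ⋆ V ⊕ X V)
  denominator-step {S} {B} {Q} {V} {P} {W} S≗ QV≗ W≗ n = begin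
    (S ⋆ W) n
      ≡⟨ ⋆-congʳ S W≗ n ⟩
    (S ⋆ (+ 2 · V ⊕ - + 4 · X (X P))) n
      ≡⟨ ⋆-distribˡ-⊕ S (+ 2 · V) (- + 4 · X (X P)) n ⟩
    (S ⋆ (+ 2 · V)) n + (S ⋆ (- + 4 · X (X P))) n
      ≡⟨ cong₂ _+_ (⋆-·ʳ (+ 2) S V n) (⋆-·ʳ (- + 4) S (X (X P)) n) ⟩
    + 2 * (S ⋆ V) n + - + 4 * (S ⋆ X (X P)) n
      ≡⟨ cong₂ (λ a b → + 2 * a + b) (S⋆V n) (halve ((S ⋆ X (X P)) n)) ⟩
    + 2 * ((B ⋆ V) n + X (V ⊕ R) n) + - + 2 * (+ 2 * (S ⋆ X (X P)) n)
      ≡⟨ cong₂ (λ a b → + 2 * ((B ⋆ V) n + a) + - + 2 * b) (X-⊕ V R n) (twice-S⋆X²P n) ⟩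
    + 2 * ((B ⋆ V) n + (X V n + X R n)) + - + 2 * X R n
      ≡⟨ cancel ((B ⋆ V) n) (X V n) (X R n) ⟩
    + 2 * ((B ⋆ V) n + X V n) ∎
    where
    R : Series
    R = S ⋆ (Q ⋆ V)
    halve : ∀ a → - + 4 * a ≡ - + 2 * (+ 2 * a)
    halve = solve-∀
    cancel : ∀ a v r → + 2 * (a + (v + r)) + - + 2 * r ≡ + 2 * (a + v)
    cancel = solve-∀
    QS⋆V : (Q ⋆ S) ⋆ V ≗ R
    QS⋆V k = trans (⋆-congˡ V (⋆-comm Q S) k) (⋆-assoc S Q V k)
    S⋆V : S ⋆ V ≗ B ⋆ V ⊕ X (V ⊕ R)
    S⋆V k = begin
      (S ⋆ V) k                                 ≡⟨ ⋆-congˡ V S≗ k ⟩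
      ((B ⊕ X (one ⊕ Q ⋆ S)) ⋆ V) k             ≡⟨ ⋆-distribʳ-⊕ V B (X (one ⊕ Q ⋆ S)) k ⟩
      (B ⋆ V) k + (X (one ⊕ Q ⋆ S) ⋆ V) k       ≡⟨ cong (_+_ ((B ⋆ V) k)) (X-⋆ (one ⊕ Q ⋆ S) V k) ⟩
      (B ⋆ V) k + X ((one ⊕ Q ⋆ S) ⋆ V) k       ≡⟨ cong (_+_ ((B ⋆ V) k)) (X-cong expand k) ⟩
      (B ⋆ V) k + X (V ⊕ R) k                   ∎
      where
      expand : (one ⊕ Q ⋆ S) ⋆ V ≗ V ⊕ R
      expand j = trans (⋆-distribʳ-⊕ V one (Q ⋆ S) j) (cong₂ _+_ (one-⋆ V j) (QS⋆V j))
    twice-S⋆X²P : ∀ k → + 2 * (S ⋆ X (X P)) k ≡ X R k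
    twice-S⋆X²P k = begin
      + 2 * (S ⋆ X (X P)) k    ≡⟨ ⋆-·ʳ (+ 2) S (X (X P)) k ⟨
      (S ⋆ (+ 2 · X (X P))) k  ≡⟨ ⋆-congʳ S (X-· (+ 2) (X P)) k ⟩
      (S ⋆ X (+ 2 · X P)) k    ≡⟨ ⋆-congʳ S (X-cong (λ j → sym (QV≗ j))) k ⟩
      (S ⋆ X (Q ⋆ V)) k        ≡⟨ ⋆-X S (Q ⋆ V) k ⟩
      X R k                    ∎

  module Denominators (O : ℕ → Series) (O-zero : O 0 ≗ 𝟘)
                      (O-suc : ∀ t → O (suc t) ≗ X (one ⊕ O t ⋆ O (suc t))) where

    O⋆Uhat : ∀ t → O t ⋆ Uhat t ≗ + 2 · X (Uprev t)
    O⋆Uhat zero zero = trans (⋆-congˡ (Uhat 0) O-zero 0) (𝟘-⋆ (Uhat 0) 0)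
    O⋆Uhat zero (suc n) = trans (⋆-congˡ (Uhat 0) O-zero (suc n)) (𝟘-⋆ (Uhat 0) (suc n))
    O⋆Uhat (suc t) n = begin
      (O (suc t) ⋆ Uhat (suc t)) n     ≡⟨ denominator-step {B = 𝟘} {Q = O t} O-suc′ (O⋆Uhat t) (Uhat-step t) n ⟩
      + 2 * ((𝟘 ⋆ Uhat t) n + X (Uhat t) n) ≡⟨ cong (λ a → + 2 * (a + X (Uhat t) n)) (𝟘-⋆ (Uhat t) n) ⟩
      + 2 * (0ℤ + X (Uhat t) n)       ≡⟨ cong (+ 2 *_) (ℤP.+-identityˡ _) ⟩
      + 2 * X (Uhat t) n              ∎
      where
      O-suc′ : O (suc t) ≗ 𝟘 ⊕ X (one ⊕ O t ⋆ O (suc t))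
      O-suc′ k = trans (O-suc t k) (sym (ℤP.+-identityˡ _))

    ⋆Uhat : ∀ t {A : Series} → A ≗ one ⊕ X (one ⊕ O t ⋆ A) → A ⋆ Uhat (suc t) ≗ + 2 · (Uhat t ⊕ X (Uhat t))
    ⋆Uhat t A≗ n = trans (denominator-step {B = one} {Q = O t} A≗ (O⋆Uhat t) (Uhat-step t) n)
      (cong (λ a → + 2 * (a + X (Uhat t) n)) (one-⋆ (Uhat t) n))

  -- Two-step recursion, so that the mutual alternation lemmas can pass the parity along definitionally.
  odd : ℕ → Bool
  odd zero = false
  odd (suc zero) = true
  odd (suc (suc n)) = odd n

  odd-suc : ∀ n → odd (suc n) ≡ not (odd n)
  odd-suc zero = refl
  odd-suc (suc n) = trans (sym (BoolP.not-involutive (odd n))) (cong not (sym (odd-suc n)))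

  odd-+ : ∀ m n → odd (m ℕ.+ n) ≡ odd m xor odd n
  odd-+ zero n = refl
  odd-+ (suc zero) n = odd-suc n
  odd-+ (suc (suc m)) n = odd-+ m n

  odd-∸-odd : ∀ {n i} → i ≤ n → odd i ≡ true → odd (n ∸ i) ≡ not (odd n)
  odd-∸-odd {n} {i} i≤n odd-i = begin
    odd (n ∸ i)                   ≡⟨ BoolP.not-involutive _ ⟨
    not (not (odd (n ∸ i)))       ≡⟨ cong not (trans (BoolP.xor-comm true (odd (n ∸ i)))
                                                          (cong (odd (n ∸ i) xor_) (sym odd-i))) ⟩
    not (odd (n ∸ i) xor odd i)   ≡⟨ cong not (odd-+ (n ∸ i) i) ⟨
    not (odd (n ∸ i ℕ.+ i))       ≡⟨ cong (λ k → not (odd k)) (ℕP.m∸n+n≡m i≤n) ⟩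
    not (odd n)                   ∎

  oddPart : Series → Series
  oddPart f n = if odd n then f n else 0ℤ

  evenPart : Series → Series
  evenPart f n = if odd n then 0ℤ else f n

  oddPart-cong : ∀ {f g : Series} → f ≗ g → oddPart f ≗ oddPart g
  oddPart-cong f≗g n = cong (if odd n then_else 0ℤ) (f≗g n)

  oddPart-idem : ∀ (f : Series) → oddPart (oddPart f) ≗ oddPart f
  oddPart-idem f n with odd n
  ... | true = refl
  ... | false = refl

  oddPart-vanishes : ∀ {f : Series} {i} → f ≗ oddPart f → odd i ≡ false → f i ≡ 0ℤ
  oddPart-vanishes {f} {i} f-odd even-i = trans (f-odd i) (cong (if_then f i else 0ℤ) even-i)

  oddPart-⋆ : ∀ {f} (g : Series) → f ≗ oddPart f → f ⋆ oddPart g ≗ evenPart (f ⋆ g)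
  oddPart-⋆ {f} g f-odd n with odd n in odd-n
  ... | true = trans (sumTo-cong n vanishes) (sumTo-zero n (λ _ → refl))
    where
    vanishes : ∀ i → i ≤ n → f i * oddPart g (n ∸ i) ≡ 0ℤ
    vanishes i i≤n with odd i in odd-i
    ... | false = cong (_* oddPart g (n ∸ i)) (oddPart-vanishes f-odd odd-i)
    ... | true rewrite odd-∸-odd i≤n odd-i | odd-n = ℤP.*-zeroʳ (f i)
  ... | false = sumTo-cong n agrees
    where
    agrees : ∀ i → i ≤ n → f i * oddPart g (n ∸ i) ≡ f i * g (n ∸ i)
    agrees i i≤n with odd i in odd-i
    ... | false = trans (cong (_* oddPart g (n ∸ i)) f-i≡0) (sym (cong (_* g (n ∸ i)) f-i≡0))
      where
      f-i≡0 : f i ≡ 0ℤ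
      f-i≡0 = oddPart-vanishes f-odd odd-i
    ... | true rewrite odd-∸-odd i≤n odd-i | odd-n = refl

  oddPart-recurrence : ∀ {f} (g : Series) → f ≗ oddPart f →
    oddPart (one ⊕ X (one ⊕ f ⋆ g)) ≗ X (one ⊕ f ⋆ oddPart g)
  oddPart-recurrence g f-odd zero = refl
  oddPart-recurrence {f} g f-odd (suc n) = begin
    oddPart (one ⊕ X (one ⊕ f ⋆ g)) (suc n)   ≡⟨ shifted n ⟩
    one n + evenPart (f ⋆ g) n                ≡⟨ cong (_+_ (one n)) (oddPart-⋆ g f-odd n) ⟨
    one n + (f ⋆ oddPart g) n                 ∎
    where
    shifted : ∀ n → oddPart (one ⊕ X (one ⊕ f ⋆ g)) (suc n) ≡ one n + evenPart (f ⋆ g) n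
    shifted zero = ℤP.+-identityˡ _
    shifted (suc n) rewrite odd-suc n with odd n
    ... | true = ℤP.+-identityˡ _
    ... | false = refl

module Permutations where

  open PowerSeries using (odd)
  open import Data.Nat using (ℕ; zero; suc; _+_; _∸_; _<_; _≤_; z≤n; s≤s; _≤?_; _<?_)
  import Data.Nat.Properties as ℕP
  open import Data.Bool using (true; false; T; if_then_else_)
  open import Data.Empty using (⊥-elim)
  open import Data.Fin using (Fin; cast) renaming (zero to fzero; suc to fsuc)
  open import Data.List using (List; []; _∷_; [_]; _++_; length; map; upTo; lookup; filter; cartesianProductWith)
  import Data.List.Properties as ListP
  open import Data.List.Membership.Propositional using (_∈_)
  open import Data.List.Membership.Propositional.Properties
    using ( ∈-∃++; ∈-lookup; ∈-map⁺; ∈-map⁻; ∈-upTo⁺; ∈-upTo⁻; ∈-++⁺ˡ; ∈-++⁺ʳ; ∈-++⁻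
          ; ∈-cartesianProductWith⁺; ∈-cartesianProductWith⁻)
  open import Data.List.Membership.Propositional.Properties.WithK using (unique∧set⇒bag)
  open import Data.List.Relation.Unary.All as All using (All; []; _∷_)
  import Data.List.Relation.Unary.All.Properties as AllP
  open import Data.List.Relation.Unary.AllPairs as AllPairs using (AllPairs; []; _∷_)
  import Data.List.Relation.Unary.AllPairs.Properties as AllPairsP
  open import Data.List.Relation.Unary.Any as Any using (here; there; index)
  open import Data.List.Relation.Unary.Any.Properties using (lookup-index)
  open import Data.List.Relation.Unary.Unique.Propositional using (Unique)
  import Data.List.Relation.Unary.Unique.Propositional.Properties as UniqueP
  open import Data.List.Relation.Binary.BagAndSetEquality using (∼bag⇒↭)
  open import Data.List.Relation.Binary.Disjoint.Propositional using (Disjoint)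
  open import Data.List.Relation.Binary.Permutation.Propositional
    using (_↭_; ↭-refl; ↭-sym; ↭-reflexive; ↭⇒↭ₛ; module PermutationReasoning)
  open import Data.List.Relation.Binary.Permutation.Propositional.Properties as PermP
    using (∈-resp-↭; ↭-length; ↭-empty-inv; filter-↭)
  import Data.List.Relation.Binary.Permutation.Setoid.Properties as PermₛP
  open import Data.List.Relation.Binary.Sublist.Propositional using (_⊆_; []; _∷_; _∷ʳ_; ⊆-refl; ⊆-trans; to∈; from∈)
  import Data.List.Relation.Binary.Sublist.Propositional.Properties as SublistP
  open import Data.Product using (∃-syntax; ∃₂; _×_; _,_; proj₁; proj₂)
  open import Data.Product.Function.NonDependent.Propositional using (_×-⇔_)
  open import Data.Sum using (_⊎_; inj₁; inj₂; [_,_]′)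
  open import Data.Unit using (tt)
  open import Function using (_∘_; id)
  open import Function.Bundles using (_⇔_; mk⇔; Equivalence)
  open import Function.Construct.Symmetry using (⇔-sym)
  open import Relation.Binary.Definitions using (tri<; tri≈; tri>)
  open import Relation.Binary.PropositionalEquality
    using (_≡_; _≢_; refl; sym; trans; cong; cong₂; subst; subst₂; setoid; module ≡-Reasoning)
  open import Relation.Nullary using (¬_; yes; no)

  shift : ℕ → List ℕ → List ℕ
  shift m = map (m +_)

  inc-suc : ∀ n → inc (suc n) ≡ inc n ++ [ suc n ]
  inc-suc n = trans (cong (map suc) (sym (ListP.upTo-∷ʳ n))) (ListP.map-++ suc (upTo n) [ n ])

  inc-+ : ∀ m i → inc (m + i) ≡ inc m ++ shift m (inc i)
  inc-+ m zero = trans (cong inc (ℕP.+-identityʳ m)) (sym (ListP.++-identityʳ (inc m)))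
  inc-+ m (suc i) = begin
    inc (m + suc i)                                  ≡⟨ cong inc (ℕP.+-suc m i) ⟩
    inc (suc (m + i))                                ≡⟨ inc-suc (m + i) ⟩
    inc (m + i) ++ [ suc (m + i) ]                   ≡⟨ cong (_++ [ suc (m + i) ]) (inc-+ m i) ⟩
    (inc m ++ shift m (inc i)) ++ [ suc (m + i) ]    ≡⟨ ListP.++-assoc (inc m) _ _ ⟩
    inc m ++ (shift m (inc i) ++ [ suc (m + i) ])    ≡⟨ cong (λ k → inc m ++ (shift m (inc i) ++ [ k ])) (ℕP.+-suc m i) ⟨
    inc m ++ (shift m (inc i) ++ shift m [ suc i ])  ≡⟨ cong (inc m ++_) (ListP.map-++ (m +_) (inc i) [ suc i ]) ⟨
    inc m ++ shift m (inc i ++ [ suc i ])            ≡⟨ cong (λ xs → inc m ++ shift m xs) (inc-suc i) ⟨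
    inc m ++ shift m (inc (suc i))                   ∎
    where open ≡-Reasoning

  ∈-inc⁻ : ∀ {n v} → v ∈ inc n → 0 < v × v ≤ n
  ∈-inc⁻ v∈ with ∈-map⁻ suc v∈
  ... | _ , u∈ , refl = s≤s z≤n , ∈-upTo⁻ u∈

  ∈-inc⁺ : ∀ {n v} → 0 < v → v ≤ n → v ∈ inc n
  ∈-inc⁺ {v = suc v} _ v<n = ∈-map⁺ suc (∈-upTo⁺ v<n)

  length-inc : ∀ n → length (inc n) ≡ n
  length-inc n = trans (ListP.length-map suc (upTo n)) (ListP.length-upTo n)

  inc-increasing : ∀ n → AllPairs _<_ (inc n)
  inc-increasing n = AllPairsP.map⁺ (AllPairsP.applyUpTo⁺₁ id n (λ i<j _ → s≤s i<j))

  inc-unique : ∀ n → Unique (inc n)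
  inc-unique n = UniqueP.map⁺ ℕP.suc-injective (UniqueP.upTo⁺ n)

  perm-∈ : ∀ {n w v} → IsPerm n w → v ∈ w → 0 < v × v ≤ n
  perm-∈ w↭ v∈ = ∈-inc⁻ (∈-resp-↭ w↭ v∈)

  perm-length : ∀ {n w} → IsPerm n w → length w ≡ n
  perm-length {n} w↭ = trans (↭-length w↭) (length-inc n)

  perm-unique : ∀ {n w} → IsPerm n w → Unique w
  perm-unique {n} w↭ = PermₛP.Unique-resp-↭ (setoid ℕ) (↭⇒↭ₛ (↭-sym w↭)) (inc-unique n)

  Has132 : List ℕ → Set
  Has132 w = ∃[ a ] ∃[ b ] ∃[ c ] (a ∷ b ∷ c ∷ []) ⊆ w × a < c × c < b

  HasIncreasing : ℕ → List ℕ → Set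
  HasIncreasing k w = ∃[ u ] u ⊆ w × length u ≡ k × AllPairs _<_ u

  both : ∀ {P Q : Set} → P → Q → P ⇔ Q
  both p q = mk⇔ (λ _ → q) (λ _ → p)

  neither : ∀ {P Q : Set} → ¬ P → ¬ Q → P ⇔ Q
  neither ¬p ¬q = mk⇔ (⊥-elim ∘ ¬p) (⊥-elim ∘ ¬q)

  occurs-132⇔ : ∀ {w} → Occurs p132 w ⇔ Has132 w
  occurs-132⇔ = mk⇔ to from
    where
    to : ∀ {w} → Occurs p132 w → Has132 w
    to ((a ∷ b ∷ c ∷ []) , sub , _ , iso) =
      a , b , c , sub , Equivalence.from (iso fzero (fsuc (fsuc fzero))) (s≤s (s≤s z≤n))
                      , Equivalence.from (iso (fsuc (fsuc fzero)) (fsuc fzero)) (s≤s (s≤s (s≤s z≤n)))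
    from : ∀ {w} → Has132 w → Occurs p132 w
    from (a , b , c , sub , a<c , c<b) = (a ∷ b ∷ c ∷ []) , sub , refl , iso
      where
      a<b : a < b
      a<b = ℕP.<-trans a<c c<b
      irrefl : ∀ {x} → ¬ x < x
      irrefl = ℕP.<-irrefl refl
      iso : (i j : Fin 3) → (lookup (a ∷ b ∷ c ∷ []) i < lookup (a ∷ b ∷ c ∷ []) j)
                           ⇔ (lookup p132 (cast refl i) < lookup p132 (cast refl j))
      iso fzero fzero = neither irrefl irrefl
      iso fzero (fsuc fzero) = both a<b (s≤s (s≤s z≤n))
      iso fzero (fsuc (fsuc fzero)) = both a<c (s≤s (s≤s z≤n))
      iso (fsuc fzero) fzero = neither (ℕP.<-asym a<b) λ { (s≤s ()) }
      iso (fsuc fzero) (fsuc fzero) = neither irrefl irrefl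
      iso (fsuc fzero) (fsuc (fsuc fzero)) = neither (ℕP.<-asym c<b) λ { (s≤s (s≤s ())) }
      iso (fsuc (fsuc fzero)) fzero = neither (ℕP.<-asym a<c) λ { (s≤s ()) }
      iso (fsuc (fsuc fzero)) (fsuc fzero) = both c<b (s≤s (s≤s (s≤s z≤n)))
      iso (fsuc (fsuc fzero)) (fsuc (fsuc fzero)) = neither irrefl irrefl

  All-lookup : ∀ {P : ℕ → Set} {xs} → All P xs → (i : Fin (length xs)) → P (lookup xs i)
  All-lookup pxs i = All.lookup pxs (∈-lookup i)

  All-tabulate : ∀ {P : ℕ → Set} {xs} → ((i : Fin (length xs)) → P (lookup xs i)) → All P xs
  All-tabulate {P} p = All.tabulate (λ x∈ → subst P (sym (lookup-index x∈)) (p (index x∈)))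

  OrderIso-increasing : ∀ {u τ} → AllPairs _<_ τ → OrderIso u τ ⇔ (length u ≡ length τ × AllPairs _<_ u)
  OrderIso-increasing τ↑ = mk⇔ (λ iso → proj₁ iso , to τ↑ iso) (λ (eq , u↑) → from eq u↑ τ↑)
    where
    to : ∀ {u τ} → AllPairs _<_ τ → OrderIso u τ → AllPairs _<_ u
    to {[]} _ _ = []
    to {x ∷ u} {y ∷ τ} (y< ∷ τ↑) (eq , iso) =
      All-tabulate (λ i → Equivalence.from (iso fzero (fsuc i)) (All-lookup y< _))
      ∷ to τ↑ (ℕP.suc-injective eq , λ i j → iso (fsuc i) (fsuc j))
    from : ∀ {u τ} → length u ≡ length τ → AllPairs _<_ u → AllPairs _<_ τ → OrderIso u τ
    from {[]} {[]} eq _ _ = eq , λ ()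
    from {x ∷ u} {y ∷ τ} eq (x< ∷ u↑) (y< ∷ τ↑) = eq , iso
      where
      iso : (i j : Fin (length (x ∷ u))) →
        (lookup (x ∷ u) i < lookup (x ∷ u) j) ⇔ (lookup (y ∷ τ) (cast eq i) < lookup (y ∷ τ) (cast eq j))
      iso fzero fzero = neither (ℕP.<-irrefl refl) (ℕP.<-irrefl refl)
      iso fzero (fsuc j) = both (All-lookup x< j) (All-lookup y< _)
      iso (fsuc i) fzero = neither (ℕP.<-asym (All-lookup x< i)) (ℕP.<-asym (All-lookup y< _))
      iso (fsuc i) (fsuc j) = proj₂ (from (ℕP.suc-injective eq) u↑ τ↑) i j

  occurs-inc⇔ : ∀ {k w} → Occurs (inc k) w ⇔ HasIncreasing k w
  occurs-inc⇔ {k} = mk⇔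
    (λ (u , sub , iso) → let (eq , u↑) = Equivalence.to (OrderIso-increasing (inc-increasing k)) iso
                         in u , sub , trans eq (length-inc k) , u↑)
    (λ (u , sub , eq , u↑) → u , sub , Equivalence.from (OrderIso-increasing (inc-increasing k))
                                          (trans eq (sym (length-inc k)) , u↑))

  record Valid (k n : ℕ) (w : List ℕ) : Set where
    field
      perm        : IsPerm n w
      alternating : Alternating w
      avoids132   : ¬ Has132 w
      avoidsInc   : ¬ HasIncreasing k w

  counted⇔valid : ∀ {k n w} → Counted k n w ⇔ Valid k n w
  counted⇔valid = mk⇔
    (λ (p , a , c , d) → record { perm = p ; alternating = a
                                ; avoids132 = c ∘ Equivalence.from occurs-132⇔
                                ; avoidsInc = d ∘ Equivalence.from occurs-inc⇔ })
    (λ v → let open Valid v in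
       perm , alternating , avoids132 ∘ Equivalence.to occurs-132⇔ , avoidsInc ∘ Equivalence.to occurs-inc⇔)

  ⊆-++⁻ : ∀ {u} xs {ys : List ℕ} → u ⊆ xs ++ ys → ∃₂ λ u₁ u₂ → u ≡ u₁ ++ u₂ × u₁ ⊆ xs × u₂ ⊆ ys
  ⊆-++⁻ [] sub = [] , _ , refl , [] , sub
  ⊆-++⁻ (x ∷ xs) (.x ∷ʳ sub) with ⊆-++⁻ xs sub
  ... | u₁ , u₂ , refl , sub₁ , sub₂ = u₁ , u₂ , refl , x ∷ʳ sub₁ , sub₂
  ⊆-++⁻ (x ∷ xs) (refl ∷ sub) with ⊆-++⁻ xs sub
  ... | u₁ , u₂ , refl , sub₁ , sub₂ = x ∷ u₁ , u₂ , refl , refl ∷ sub₁ , sub₂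

  ⊆-map⁻ : ∀ (f : ℕ → ℕ) {u} xs → u ⊆ map f xs → ∃[ u′ ] u ≡ map f u′ × u′ ⊆ xs
  ⊆-map⁻ f [] [] = [] , refl , []
  ⊆-map⁻ f (x ∷ xs) (.(f x) ∷ʳ sub) with ⊆-map⁻ f xs sub
  ... | u′ , refl , sub′ = u′ , refl , x ∷ʳ sub′
  ⊆-map⁻ f (x ∷ xs) (refl ∷ sub) with ⊆-map⁻ f xs sub
  ... | u′ , refl , sub′ = x ∷ u′ , refl , refl ∷ sub′

  AllPairs-++⁻ : ∀ {R : ℕ → ℕ → Set} xs {ys} → AllPairs R (xs ++ ys) →
    AllPairs R xs × All (λ x → All (R x) ys) xs × AllPairs R ys
  AllPairs-++⁻ [] r = [] , [] , r
  AllPairs-++⁻ (x ∷ xs) (rx ∷ r) with AllPairs-++⁻ xs r | AllP.++⁻ xs rx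
  ... | r₁ , cross , r₂ | rx₁ , rx₂ = rx₁ ∷ r₁ , rx₂ ∷ cross , r₂

  module OrderEmbedding {f : ℕ → ℕ} (f-< : ∀ {x y} → x < y ⇔ f x < f y) where

    Has132-map : ∀ {w} → Has132 (map f w) ⇔ Has132 w
    Has132-map {w} = mk⇔ to from
      where
      to : Has132 (map f w) → Has132 w
      to (_ , _ , _ , sub , a<c , c<b) with ⊆-map⁻ f w sub
      ... | a ∷ b ∷ c ∷ [] , refl , sub′ = a , b , c , sub′ , Equivalence.from f-< a<c , Equivalence.from f-< c<b
      from : Has132 w → Has132 (map f w)
      from (a , b , c , sub , a<c , c<b) =
        f a , f b , f c , SublistP.map⁺ f sub , Equivalence.to f-< a<c , Equivalence.to f-< c<b

    HasIncreasing-map : ∀ {k w} → HasIncreasing k (map f w) ⇔ HasIncreasing k w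
    HasIncreasing-map {k} {w} = mk⇔ to from
      where
      to : HasIncreasing k (map f w) → HasIncreasing k w
      to (_ , sub , len , u↑) with ⊆-map⁻ f w sub
      ... | u , refl , sub′ =
        u , sub′ , trans (sym (ListP.length-map f u)) len , AllPairs.map (Equivalence.from f-<) (AllPairsP.map⁻ u↑)
      from : HasIncreasing k w → HasIncreasing k (map f w)
      from (u , sub , len , u↑) =
        map f u , SublistP.map⁺ f sub , trans (ListP.length-map f u) len
        , AllPairsP.map⁺ (AllPairs.map (Equivalence.to f-<) u↑)

    mutual
      AltUp-map : ∀ w → AltUp (map f w) ⇔ AltUp w
      AltUp-map [] = both tt tt
      AltUp-map (x ∷ []) = both tt tt
      AltUp-map (x ∷ y ∷ r) = ⇔-sym f-< ×-⇔ AltDown-map (y ∷ r)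

      AltDown-map : ∀ w → AltDown (map f w) ⇔ AltDown w
      AltDown-map [] = both tt tt
      AltDown-map (x ∷ []) = both tt tt
      AltDown-map (x ∷ y ∷ r) = ⇔-sym f-< ×-⇔ AltUp-map (y ∷ r)

  shift-< : ∀ m {x y} → x < y ⇔ m + x < m + y
  shift-< m = mk⇔ (ℕP.+-monoʳ-< m) (ℕP.+-cancelˡ-< m _ _)

  Above : List ℕ → List ℕ → Set
  Above xs ys = ∀ {x y} → x ∈ xs → y ∈ ys → y < x

  join-avoids132 : ∀ {xs ys n} → All (_< n) xs → All (_< n) ys → Above xs ys →
    ¬ Has132 xs → ¬ Has132 ys → ¬ Has132 (xs ++ n ∷ ys)
  join-avoids132 {xs} {ys} {n} xs<n ys<n xs≻ys ¬xs ¬ys (a , b , c , sub , a<c , c<b) with ⊆-++⁻ xs sub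
  ... | [] , _ , refl , _ , _ ∷ʳ sub₂ = ¬ys (a , b , c , sub₂ , a<c , c<b)
  ... | [] , _ , refl , _ , refl ∷ sub₂ = ℕP.<-asym a<c (All.lookup ys<n (to∈ (SublistP.∷ˡ⁻ sub₂)))
  ... | a ∷ [] , _ , refl , sub₁ , sub₂ = ℕP.<-asym a<c (xs≻ys (to∈ sub₁) (third∈ys sub₂))
    where
    third∈ys : (b ∷ c ∷ []) ⊆ n ∷ ys → c ∈ ys
    third∈ys (_ ∷ʳ sub) = to∈ (SublistP.∷ˡ⁻ sub)
    third∈ys (refl ∷ sub) = to∈ sub
  ... | a ∷ b ∷ [] , _ , refl , sub₁ , _ ∷ʳ sub₂ = ℕP.<-asym a<c (xs≻ys (to∈ sub₁) (to∈ sub₂))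
  ... | a ∷ b ∷ [] , _ , refl , sub₁ , refl ∷ _ = ℕP.<-asym c<b (All.lookup xs<n (to∈ (SublistP.∷ˡ⁻ sub₁)))
  ... | a ∷ b ∷ c ∷ [] , [] , refl , sub₁ , _ = ¬xs (a , b , c , sub₁ , a<c , c<b)

  -- An increasing subsequence cannot meet both xs and ys, and nothing can follow n in it.
  join-increasing⁻ : ∀ {xs ys n k} → All (_< n) ys → Above xs ys →
    HasIncreasing (suc k) (xs ++ n ∷ ys) → HasIncreasing k xs ⊎ HasIncreasing (suc k) ys
  join-increasing⁻ {xs} {ys} {n} {k} ys<n xs≻ys (u , sub , len , u↑) with ⊆-++⁻ xs sub
  ... | u₁ , u₂ , refl , sub₁ , sub₂ =
    cases u₁ u₂ sub₁ sub₂ (trans (sym (ListP.length-++ u₁)) len) (AllPairs-++⁻ u₁ u↑)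
    where
    cases : ∀ u₁ u₂ → u₁ ⊆ xs → u₂ ⊆ n ∷ ys → length u₁ + length u₂ ≡ suc k →
      AllPairs _<_ u₁ × All (λ x → All (x <_) u₂) u₁ × AllPairs _<_ u₂ →
      HasIncreasing k xs ⊎ HasIncreasing (suc k) ys
    cases [] u₂ _ (_ ∷ʳ sub₂) len (_ , _ , u₂↑) = inj₂ (u₂ , sub₂ , len , u₂↑)
    cases (x ∷ u₁) [] sub₁ (_ ∷ʳ _) len ((_ ∷ u₁↑) , _ , _) =
      inj₁ (u₁ , SublistP.∷ˡ⁻ sub₁ , trans (sym (ℕP.+-identityʳ _)) (ℕP.suc-injective len) , u₁↑)
    cases (x ∷ u₁) (z ∷ _) sub₁ (_ ∷ʳ sub₂) _ (_ , (x<z ∷ _) ∷ _ , _) =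
      ⊥-elim (ℕP.<-asym x<z (xs≻ys (to∈ sub₁) (to∈ sub₂)))
    cases u₁ (_ ∷ []) sub₁ (refl ∷ _) len (u₁↑ , _ , _) =
      inj₁ (u₁ , sub₁ , ℕP.suc-injective (trans (ℕP.+-comm 1 (length u₁)) len) , u₁↑)
    cases u₁ (_ ∷ _ ∷ _) _ (refl ∷ sub₂) _ (_ , _ , (n<y ∷ _) ∷ _) =
      ⊥-elim (ℕP.<-asym n<y (All.lookup ys<n (to∈ sub₂)))

  join-increasing⁺ : ∀ {xs n k} ys → All (_< n) xs → HasIncreasing k xs → HasIncreasing (suc k) (xs ++ n ∷ ys)
  join-increasing⁺ ys xs<n (u , sub , len , u↑) =
    u ++ [ _ ] , SublistP.++⁺ sub (refl ∷ SublistP.[]⊆-universal ys)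
    , trans (ListP.length-++ u) (trans (ℕP.+-comm (length u) 1) (cong suc len))
    , AllPairsP.++⁺ u↑ ([] ∷ []) (All.map (_∷ []) (SublistP.All-resp-⊆ sub xs<n))

  mutual
    AltUp-join : ∀ {n ys} xs → AltUp xs → T (odd (length xs)) → All (_< n) xs → AltDown (n ∷ ys) →
      AltUp (xs ++ n ∷ ys)
    AltUp-join (x ∷ []) _ _ (x<n ∷ _) down = x<n , down
    AltUp-join (x ∷ y ∷ r) (x<y , alt) odd-xs (_ ∷ r<n) down = x<y , AltDown-join (y ∷ r) alt odd-xs r<n down

    AltDown-join : ∀ {n ys} xs → AltDown xs → T (odd (suc (length xs))) → All (_< n) xs → AltDown (n ∷ ys) →
      AltDown (xs ++ n ∷ ys)
    AltDown-join [] _ _ _ down = down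
    AltDown-join (x ∷ y ∷ r) (x>y , alt) odd-xs (_ ∷ r<n) down = x>y , AltUp-join (y ∷ r) alt odd-xs r<n down

  mutual
    AltUp-++⁻ˡ : ∀ xs {zs} → AltUp (xs ++ zs) → AltUp xs
    AltUp-++⁻ˡ [] _ = tt
    AltUp-++⁻ˡ (x ∷ []) _ = tt
    AltUp-++⁻ˡ (x ∷ y ∷ r) (x<y , alt) = x<y , AltDown-++⁻ˡ (y ∷ r) alt

    AltDown-++⁻ˡ : ∀ xs {zs} → AltDown (xs ++ zs) → AltDown xs
    AltDown-++⁻ˡ [] _ = tt
    AltDown-++⁻ˡ (x ∷ []) _ = tt
    AltDown-++⁻ˡ (x ∷ y ∷ r) (x>y , alt) = x>y , AltUp-++⁻ˡ (y ∷ r) alt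

  mutual
    AltUp-++⁻ʳ : ∀ xs {zs} → AltUp (xs ++ zs) → T (odd (length xs)) → AltDown zs
    AltUp-++⁻ʳ (x ∷ []) {[]} _ _ = tt
    AltUp-++⁻ʳ (x ∷ []) {z ∷ zs} (_ , alt) _ = alt
    AltUp-++⁻ʳ (x ∷ y ∷ r) (_ , alt) odd-xs = AltDown-++⁻ʳ (y ∷ r) alt odd-xs

    AltDown-++⁻ʳ : ∀ xs {zs} → AltDown (xs ++ zs) → T (odd (suc (length xs))) → AltDown zs
    AltDown-++⁻ʳ [] alt _ = alt
    AltDown-++⁻ʳ (x ∷ y ∷ r) (_ , alt) odd-xs = AltUp-++⁻ʳ (y ∷ r) alt odd-xs

  mutual
    AltUp-maximum : ∀ xs {n ys} → AltUp (xs ++ n ∷ ys) → All (_< n) xs → All (_< n) ys →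
      T (odd (length xs)) ⊎ (xs ≡ [] × ys ≡ [])
    AltUp-maximum [] {ys = []} _ _ _ = inj₂ (refl , refl)
    AltUp-maximum [] {ys = y ∷ _} (n<y , _) _ (y<n ∷ _) = ⊥-elim (ℕP.<-asym n<y y<n)
    AltUp-maximum (x ∷ []) _ _ _ = inj₁ tt
    AltUp-maximum (x ∷ y ∷ r) (_ , alt) (_ ∷ r<n) ys<n = inj₁ (AltDown-maximum (y ∷ r) alt r<n ys<n)

    AltDown-maximum : ∀ xs {n ys} → AltDown (xs ++ n ∷ ys) → All (_< n) xs → All (_< n) ys →
      T (odd (suc (length xs)))
    AltDown-maximum [] _ _ _ = tt
    AltDown-maximum (x ∷ []) (n<x , _) (x<n ∷ _) _ = ⊥-elim (ℕP.<-asym n<x x<n)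
    AltDown-maximum (x ∷ y ∷ r) (_ , alt) (_ ∷ r<n) ys<n with AltUp-maximum (y ∷ r) alt r<n ys<n
    ... | inj₁ odd-r = odd-r

  inc-≤ : ∀ m → All (_≤ m) (inc m)
  inc-≤ m = All.tabulate (proj₂ ∘ ∈-inc⁻)

  shift-inc-> : ∀ m i → All (m <_) (shift m (inc i))
  shift-inc-> m i = AllP.map⁺ (All.tabulate (ℕP.m<m+n m ∘ proj₁ ∘ ∈-inc⁻))

  module _ (m i : ℕ) where

    filter-≤-inc : filter (_≤? m) (inc m ++ shift m (inc i)) ≡ inc m
    filter-≤-inc = begin
      filter (_≤? m) (inc m ++ shift m (inc i))                   ≡⟨ ListP.filter-++ (_≤? m) (inc m) _ ⟩
      filter (_≤? m) (inc m) ++ filter (_≤? m) (shift m (inc i))  ≡⟨ cong₂ _++_ (ListP.filter-all (_≤? m) (inc-≤ m))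
                                                                       (ListP.filter-none (_≤? m) (All.map ℕP.<⇒≱ (shift-inc-> m i))) ⟩
      inc m ++ []                                                 ≡⟨ ListP.++-identityʳ (inc m) ⟩
      inc m                                                       ∎
      where open ≡-Reasoning

    filter->-inc : filter (m <?_) (inc m ++ shift m (inc i)) ≡ shift m (inc i)
    filter->-inc = trans (ListP.filter-++ (m <?_) (inc m) _)
      (cong₂ _++_ (ListP.filter-none (m <?_) (All.map ℕP.≤⇒≯ (inc-≤ m))) (ListP.filter-all (m <?_) (shift-inc-> m i)))

    -- Count the entries ≤ m: there are m of them, but an entry ≤ m in xs would lie above all m entries of ys.
    split-bounds : ∀ {xs ys} → xs ++ ys ↭ inc m ++ shift m (inc i) → length ys ≡ m → Above xs ys →
      All (m <_) xs × All (_≤ m) ys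
    split-bounds {xs} {ys} xs++ys↭ len xs≻ys = xs>m , ys≤m
      where
      filtered-length : length (filter (_≤? m) xs) + length (filter (_≤? m) ys) ≡ m
      filtered-length = begin
        length (filter (_≤? m) xs) + length (filter (_≤? m) ys) ≡⟨ ListP.length-++ (filter (_≤? m) xs) ⟨
        length (filter (_≤? m) xs ++ filter (_≤? m) ys)          ≡⟨ cong length (ListP.filter-++ (_≤? m) xs ys) ⟨
        length (filter (_≤? m) (xs ++ ys))                        ≡⟨ ↭-length (filter-↭ (_≤? m) xs++ys↭) ⟩
        length (filter (_≤? m) (inc m ++ shift m (inc i)))        ≡⟨ cong length filter-≤-inc ⟩
        length (inc m)                                            ≡⟨ length-inc m ⟩
        m                                                         ∎
        where open ≡-Reasoning
      xs>m : All (m <_) xs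
      xs>m = All.tabulate above
        where
        above : ∀ {x} → x ∈ xs → m < x
        above {x} x∈ with x ≤? m
        ... | no x≰m = ℕP.≰⇒> x≰m
        ... | yes x≤m = ⊥-elim (ℕP.<-irrefl refl (subst (m <_) filtered-length too-many))
          where
          too-many : m < length (filter (_≤? m) xs) + length (filter (_≤? m) ys)
          too-many rewrite ListP.filter-all (_≤? m) (All.tabulate (λ y∈ → ℕP.<⇒≤ (ℕP.<-≤-trans (xs≻ys x∈ y∈) x≤m)))
            | len = ℕP.m<n+m m (ListP.filter-some (_≤? m) (Any.map (λ { refl → x≤m }) x∈))
      ys≤m : All (_≤ m) ys
      ys≤m = subst (All (_≤ m)) (ListP.filter-complete (_≤? m) (trans lengths (sym len))) (AllP.all-filter (_≤? m) ys)
        where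
        lengths : length (filter (_≤? m) ys) ≡ m
        lengths = subst (λ l → length l + length (filter (_≤? m) ys) ≡ m)
          (ListP.filter-none (_≤? m) (All.map ℕP.<⇒≱ xs>m)) filtered-length

    split-perm : ∀ {xs ys} → All (m <_) xs → All (_≤ m) ys → xs ++ ys ↭ inc m ++ shift m (inc i) →
      ys ↭ inc m × xs ↭ shift m (inc i)
    split-perm {xs} {ys} xs>m ys≤m xs++ys↭ =
      subst₂ _↭_ keep-ys filter-≤-inc (filter-↭ (_≤? m) xs++ys↭) ,
      subst₂ _↭_ keep-xs filter->-inc (filter-↭ (m <?_) xs++ys↭)
      where
      keep-ys : filter (_≤? m) (xs ++ ys) ≡ ys
      keep-ys = trans (ListP.filter-++ (_≤? m) xs ys)
        (cong₂ _++_ (ListP.filter-none (_≤? m) (All.map ℕP.<⇒≱ xs>m)) (ListP.filter-all (_≤? m) ys≤m))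
      keep-xs : filter (m <?_) (xs ++ ys) ≡ xs
      keep-xs = trans (ListP.filter-++ (m <?_) xs ys)
        (trans (cong₂ _++_ (ListP.filter-all (m <?_) xs>m) (ListP.filter-none (m <?_) (All.map ℕP.≤⇒≯ ys≤m)))
               (ListP.++-identityʳ xs))

  AltDown-∷ : ∀ {n ys} → All (_< n) ys → AltUp ys → AltDown (n ∷ ys)
  AltDown-∷ [] _ = tt
  AltDown-∷ (y<n ∷ _) alt = y<n , alt

  AltDown-∷⁻ : ∀ {n} ys → AltDown (n ∷ ys) → AltUp ys
  AltDown-∷⁻ [] _ = tt
  AltDown-∷⁻ (_ ∷ _) (_ , alt) = alt

  shift-perm-≤ : ∀ m {i α} → IsPerm i α → All (_≤ m + i) (shift m α)
  shift-perm-≤ m α-perm = AllP.map⁺ (All.tabulate (ℕP.+-monoʳ-≤ m ∘ proj₂ ∘ perm-∈ α-perm))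

  join : ℕ → ℕ → List ℕ → List ℕ → List ℕ
  join m n α β = shift m α ++ n ∷ β

  valid-[] : ∀ {k} → Valid (suc k) 0 []
  valid-[] = record
    { perm = ↭-refl ; alternating = tt
    ; avoids132 = λ { (_ , _ , _ , () , _) } ; avoidsInc = λ { ([] , [] , () , _) } }

  valid-[1] : ∀ {k} → Valid (suc (suc k)) 1 [ 1 ]
  valid-[1] = record
    { perm = ↭-refl ; alternating = tt
    ; avoids132 = λ (_ , _ , _ , sub , _) → too-long (SublistP.length-mono-≤ sub)
    ; avoidsInc = λ (_ , sub , len , _) → too-long (subst (_≤ 1) len (SublistP.length-mono-≤ sub)) }
    where
    too-long : ∀ {n} → ¬ suc (suc n) ≤ 1
    too-long (s≤s ())

  ¬valid-0 : ∀ {n w} → ¬ Valid 0 n w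
  ¬valid-0 {w = w} valid = Valid.avoidsInc valid ([] , SublistP.[]⊆-universal w , refl , [])

  valid-join : ∀ {k i m α β} → T (odd i) → Valid k i α → Valid (suc k) m β →
    Valid (suc k) (suc (m + i)) (join m (suc (m + i)) α β)
  valid-join {k} {i} {m} {α} {β} odd-i α-valid β-valid = record
    { perm = perm
    ; alternating = AltUp-join xs (Equivalence.from (AltUp-map α) (Valid.alternating α-valid)) odd-xs xs<n
                               (AltDown-∷ β<n (Valid.alternating β-valid))
    ; avoids132 = join-avoids132 xs<n β<n xs≻β (Valid.avoids132 α-valid ∘ Equivalence.to Has132-map) (Valid.avoids132 β-valid)
    ; avoidsInc = [ Valid.avoidsInc α-valid ∘ Equivalence.to HasIncreasing-map , Valid.avoidsInc β-valid ]′
                  ∘ join-increasing⁻ β<n xs≻β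
    }
    where
    open OrderEmbedding (shift-< m)
    n : ℕ
    n = suc (m + i)
    xs : List ℕ
    xs = shift m α
    xs<n : All (_< n) xs
    xs<n = All.map s≤s (shift-perm-≤ m (Valid.perm α-valid))
    β<n : All (_< n) β
    β<n = All.tabulate (λ b∈ → s≤s (ℕP.≤-trans (proj₂ (perm-∈ (Valid.perm β-valid) b∈)) (ℕP.m≤m+n m i)))
    xs≻β : Above xs β
    xs≻β x∈ b∈ with ∈-map⁻ (m +_) x∈
    ... | a , a∈ , refl = ℕP.≤-<-trans (proj₂ (perm-∈ (Valid.perm β-valid) b∈))
                                       (ℕP.m<m+n m (proj₁ (perm-∈ (Valid.perm α-valid) a∈)))
    odd-xs : T (odd (length xs))
    odd-xs = subst (T ∘ odd) (sym (trans (ListP.length-map (m +_) α) (perm-length (Valid.perm α-valid)))) odd-i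
    perm : xs ++ n ∷ β ↭ inc n
    perm = begin
      xs ++ n ∷ β                     ↭⟨ ↭-reflexive (sym (ListP.++-assoc xs [ n ] β)) ⟩
      (xs ++ [ n ]) ++ β              ↭⟨ PermP.++-comm (xs ++ [ n ]) β ⟩
      β ++ xs ++ [ n ]                ↭⟨ PermP.++⁺ (Valid.perm β-valid)
                                               (PermP.++⁺ʳ [ n ] (PermP.map⁺ (m +_) (Valid.perm α-valid))) ⟩
      inc m ++ shift m (inc i) ++ [ n ] ↭⟨ ↭-reflexive (sym (ListP.++-assoc (inc m) _ [ n ])) ⟩
      (inc m ++ shift m (inc i)) ++ [ n ] ↭⟨ ↭-reflexive (cong (_++ [ n ]) (sym (inc-+ m i))) ⟩
      inc (m + i) ++ [ n ]            ↭⟨ ↭-reflexive (sym (inc-suc (m + i))) ⟩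
      inc n                           ∎
      where open PermutationReasoning

  Has132-⊆ : ∀ {u w} → u ⊆ w → Has132 u → Has132 w
  Has132-⊆ sub (a , b , c , sub′ , a<c , c<b) = a , b , c , ⊆-trans sub′ sub , a<c , c<b

  HasIncreasing-⊆ : ∀ {k u w} → u ⊆ w → HasIncreasing k u → HasIncreasing k w
  HasIncreasing-⊆ sub (v , sub′ , len , v↑) = v , ⊆-trans sub′ sub , len , v↑

  unshift-shift : ∀ m l → map (_∸ m) (shift m l) ≡ l
  unshift-shift m [] = refl
  unshift-shift m (x ∷ l) = cong₂ _∷_ (ℕP.m+n∸m≡n m x) (unshift-shift m l)

  shift-unshift : ∀ {m xs} → All (m ≤_) xs → shift m (map (_∸ m) xs) ≡ xs
  shift-unshift [] = refl
  shift-unshift (m≤x ∷ m≤xs) = cong₂ _∷_ (ℕP.m+[n∸m]≡n m≤x) (shift-unshift m≤xs)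

  -- The shape of w when Valid (suc k) (suc N) w, split at its maximum entry suc N.
  data Decomposition : ℕ → ℕ → List ℕ → Set where
    singleton : ∀ {k} → Decomposition (suc k) 0 [ 1 ]
    joined    : ∀ {k i m α β} → T (odd i) → Valid k i α → Valid (suc k) m β →
                Decomposition k (m + i) (join m (suc (m + i)) α β)

  decompose-singleton : ∀ {k N} → Valid (suc k) (suc N) [ suc N ] → Decomposition k N [ suc N ]
  decompose-singleton {zero} valid = ⊥-elim (Valid.avoidsInc valid (_ , ⊆-refl , refl , [] ∷ []))
  decompose-singleton {suc k} {zero} valid = singleton
  decompose-singleton {suc k} {suc N} valid with () ← perm-length (Valid.perm valid)

  module _ {k N xs ys} (valid : Valid (suc k) (suc N) (xs ++ suc N ∷ ys)) where
    open Valid valid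

    private
      n : ℕ
      n = suc N

      distinct : AllPairs _≢_ xs × All (λ x → All (x ≢_) (n ∷ ys)) xs × AllPairs _≢_ (n ∷ ys)
      distinct = AllPairs-++⁻ xs (perm-unique perm)

      below-max : ∀ {v} → v ∈ xs ++ n ∷ ys → v ≢ n → v < n
      below-max v∈ v≢n = ℕP.≤∧≢⇒< (proj₂ (perm-∈ perm v∈)) v≢n

      xs<n : All (_< n) xs
      xs<n = All.tabulate (λ x∈ → below-max (∈-++⁺ˡ x∈) (All.head (All.lookup (proj₁ (proj₂ distinct)) x∈)))

      ys<n : All (_< n) ys
      ys<n with distinct
      ... | _ , _ , n≢ys ∷ _ = All.tabulate (λ y∈ → below-max (∈-++⁺ʳ xs (there y∈)) (All.lookup n≢ys y∈ ∘ sym))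

      xs≻ys : Above xs ys
      xs≻ys {x} {y} x∈ y∈ with ℕP.<-cmp x y
      ... | tri< x<y _ _ =
        ⊥-elim (avoids132 (x , n , y , SublistP.++⁺ (from∈ x∈) (refl ∷ from∈ y∈) , x<y , All.lookup ys<n y∈))
      ... | tri≈ _ x≡y _ = ⊥-elim (All.lookup (All.tail (All.lookup (proj₁ (proj₂ distinct)) x∈)) y∈ x≡y)
      ... | tri> _ _ y<x = y<x

      decompose-joined : T (odd (length xs)) → Decomposition k N (xs ++ n ∷ ys)
      decompose-joined odd-xs =
        subst₂ (λ N′ xs′ → Decomposition k N′ (xs′ ++ suc N′ ∷ ys)) (sym N≡m+i) shifted-α
               (joined odd-xs α-valid ys-valid)
        where
        i m : ℕ
        i = length xs
        m = length ys
        N≡m+i : N ≡ m + i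
        N≡m+i = ℕP.suc-injective (begin
          suc N              ≡⟨ perm-length perm ⟨
          length (xs ++ n ∷ ys) ≡⟨ ListP.length-++ xs ⟩
          i + suc m          ≡⟨ ℕP.+-suc i m ⟩
          suc (i + m)        ≡⟨ cong suc (ℕP.+-comm i m) ⟩
          suc (m + i)        ∎)
          where open ≡-Reasoning
        xs++ys↭ : xs ++ ys ↭ inc m ++ shift m (inc i)
        xs++ys↭ = subst (xs ++ ys ↭_) (trans (ListP.++-identityʳ (inc N)) (trans (cong inc N≡m+i) (inc-+ m i)))
                    (PermP.drop-mid xs (inc N) (subst (xs ++ n ∷ ys ↭_) (inc-suc N) perm))
        bounds : All (m <_) xs × All (_≤ m) ys
        bounds = split-bounds m i xs++ys↭ refl xs≻ys
        perms : ys ↭ inc m × xs ↭ shift m (inc i)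
        perms = split-perm m i (proj₁ bounds) (proj₂ bounds) xs++ys↭
        α : List ℕ
        α = map (_∸ m) xs
        shifted-α : shift m α ≡ xs
        shifted-α = shift-unshift (All.map ℕP.<⇒≤ (proj₁ bounds))
        open OrderEmbedding (shift-< m)
        α-valid : Valid k i α
        α-valid = record
          { perm = subst (α ↭_) (unshift-shift m (inc i)) (PermP.map⁺ (_∸ m) (proj₂ perms))
          ; alternating = Equivalence.to (AltUp-map α) (subst AltUp (sym shifted-α) (AltUp-++⁻ˡ xs alternating))
          ; avoids132 = avoids132 ∘ Has132-⊆ (SublistP.++⁺ʳ (n ∷ ys) ⊆-refl) ∘ subst Has132 shifted-α
                        ∘ Equivalence.from Has132-map
          ; avoidsInc = avoidsInc ∘ join-increasing⁺ ys xs<n ∘ subst (HasIncreasing k) shifted-α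
                        ∘ Equivalence.from HasIncreasing-map
          }
        ys-valid : Valid (suc k) m ys
        ys-valid = record
          { perm = proj₁ perms
          ; alternating = AltDown-∷⁻ ys (AltUp-++⁻ʳ xs alternating odd-xs)
          ; avoids132 = avoids132 ∘ Has132-⊆ (SublistP.++⁺ˡ xs (n ∷ʳ ⊆-refl))
          ; avoidsInc = avoidsInc ∘ HasIncreasing-⊆ (SublistP.++⁺ˡ xs (n ∷ʳ ⊆-refl))
          }

    decompose-around-maximum : Decomposition k N (xs ++ suc N ∷ ys)
    decompose-around-maximum with AltUp-maximum xs alternating xs<n ys<n
    ... | inj₁ odd-xs = decompose-joined odd-xs
    ... | inj₂ (refl , refl) = decompose-singleton valid

  decompose : ∀ {k N w} → Valid (suc k) (suc N) w → Decomposition k N w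
  decompose valid with ∈-∃++ (∈-resp-↭ (↭-sym (Valid.perm valid)) (∈-inc⁺ (s≤s z≤n) ℕP.≤-refl))
  ... | xs , ys , refl = decompose-around-maximum valid

  module _ {A : Set} where

    concatTo : ℕ → (ℕ → List A) → List A
    concatTo zero g = g zero
    concatTo (suc n) g = concatTo n g ++ g (suc n)

    ∈-concatTo⁻ : ∀ n {g x} → x ∈ concatTo n g → ∃[ i ] i ≤ n × x ∈ g i
    ∈-concatTo⁻ zero x∈ = 0 , z≤n , x∈
    ∈-concatTo⁻ (suc n) {g} x∈ with ∈-++⁻ (concatTo n g) x∈
    ... | inj₂ x∈g = suc n , ℕP.≤-refl , x∈g
    ... | inj₁ x∈c with ∈-concatTo⁻ n x∈c
    ...   | i , i≤n , x∈g = i , ℕP.m≤n⇒m≤1+n i≤n , x∈g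

    ∈-concatTo⁺ : ∀ {n g i x} → i ≤ n → x ∈ g i → x ∈ concatTo n g
    ∈-concatTo⁺ {zero} z≤n x∈ = x∈
    ∈-concatTo⁺ {suc n} {g} i≤1+n x∈ with ℕP.m≤n⇒m<n∨m≡n i≤1+n
    ... | inj₁ (s≤s i≤n) = ∈-++⁺ˡ (∈-concatTo⁺ i≤n x∈)
    ... | inj₂ refl = ∈-++⁺ʳ (concatTo n g) x∈

    concatTo-unique : ∀ n {g} → (∀ {i} → i ≤ n → Unique (g i)) → (∀ {i j} → i < j → j ≤ n → Disjoint (g i) (g j)) →
      Unique (concatTo n g)
    concatTo-unique zero unique _ = unique z≤n
    concatTo-unique (suc n) {g} unique disjoint = UniqueP.++⁺
      (concatTo-unique n (unique ∘ ℕP.m≤n⇒m≤1+n) (λ i<j j≤n → disjoint i<j (ℕP.m≤n⇒m≤1+n j≤n)))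
      (unique ℕP.≤-refl)
      (λ (x∈c , x∈g) → let (i , i≤n , x∈gi) = ∈-concatTo⁻ n x∈c in disjoint (s≤s i≤n) ℕP.≤-refl (x∈gi , x∈g))

    cartesianProductWith-unique : ∀ {B C : Set} {P : A → Set} (f : A → B → C) {xs ys} →
      (∀ {a a′ b b′} → P a → P a′ → f a b ≡ f a′ b′ → a ≡ a′ × b ≡ b′) →
      All P xs → Unique xs → Unique ys → Unique (cartesianProductWith f xs ys)
    cartesianProductWith-unique f _ [] [] _ = []
    cartesianProductWith-unique f {x ∷ xs} {ys} f-inj (px ∷ pxs) (x∉xs ∷ xs!) ys! = UniqueP.++⁺
      (UniqueP.map⁺ (proj₂ ∘ f-inj px px) ys!)
      (cartesianProductWith-unique f f-inj pxs xs! ys!)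
      disjoint
      where
      disjoint : Disjoint (map (f x) ys) (cartesianProductWith f xs ys)
      disjoint (v∈ , v∈′) with ∈-map⁻ (f x) v∈ | ∈-cartesianProductWith⁻ f xs ys v∈′
      ... | b , _ , refl | a , b′ , a∈ , _ , eq =
        All.lookup x∉xs a∈ (proj₁ (f-inj px (All.lookup pxs a∈) eq))

    length-unique : ∀ {xs ys : List A} → Unique xs → Unique ys → (∀ x → x ∈ xs ⇔ x ∈ ys) → length xs ≡ length ys
    length-unique xs! ys! xs⇔ys = ↭-length (∼bag⇒↭ (unique∧set⇒bag xs! ys! (λ {x} → xs⇔ys x)))

  oddOnly : ∀ {A : Set} → ℕ → List A → List A
  oddOnly i xs = if odd i then xs else []

  ∈-oddOnly⁻ : ∀ {A : Set} {x : A} i {xs} → x ∈ oddOnly i xs → T (odd i) × x ∈ xs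
  ∈-oddOnly⁻ i x∈ with odd i
  ... | true = tt , x∈

  ∈-oddOnly⁺ : ∀ {A : Set} {x : A} {i xs} → T (odd i) → x ∈ xs → x ∈ oddOnly i xs
  ∈-oddOnly⁺ {i = i} odd-i x∈ with odd i
  ... | true = x∈

  oddOnly-unique : ∀ {A : Set} i {xs : List A} → Unique xs → Unique (oddOnly i xs)
  oddOnly-unique i xs! with odd i
  ... | true = xs!
  ... | false = []

  singletons : ℕ → ℕ → List (List ℕ)
  singletons (suc k) zero = [ [ 1 ] ]
  singletons _ _ = []

  -- The first argument is fuel: enum f k n lists the valid permutations whenever n ≤ f.
  mutual
    enum : ℕ → ℕ → ℕ → List (List ℕ)
    enum _ zero _ = []
    enum _ (suc k) zero = [ [] ]
    enum zero (suc k) (suc N) = []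
    enum (suc f) (suc k) (suc N) = singletons k N ++ concatTo N (joins f k N)

    joins : ℕ → ℕ → ℕ → ℕ → List (List ℕ)
    joins f k N i = cartesianProductWith (join (N ∸ i) (suc N)) (oddOnly i (enum f k i)) (enum f (suc k) (N ∸ i))

  split-at-maximum : ∀ {n xs xs′ ys ys′} → All (_< n) xs → All (_< n) xs′ →
    xs ++ n ∷ ys ≡ xs′ ++ n ∷ ys′ → xs ≡ xs′ × ys ≡ ys′
  split-at-maximum [] [] eq = refl , ListP.∷-injectiveʳ eq
  split-at-maximum [] (x<n ∷ _) eq = ⊥-elim (ℕP.<-irrefl (sym (ListP.∷-injectiveˡ eq)) x<n)
  split-at-maximum (x<n ∷ _) [] eq = ⊥-elim (ℕP.<-irrefl (ListP.∷-injectiveˡ eq) x<n)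
  split-at-maximum (_ ∷ xs<n) (_ ∷ xs′<n) eq with split-at-maximum xs<n xs′<n (ListP.∷-injectiveʳ eq)
  ... | refl , ys≡ys′ = cong (_∷ _) (ListP.∷-injectiveˡ eq) , ys≡ys′

  shift-perm-< : ∀ {N i α} → i ≤ N → IsPerm i α → All (_< suc N) (shift (N ∸ i) α)
  shift-perm-< {N} {i} i≤N α-perm =
    All.map (λ x≤ → s≤s (subst (_ ≤_) (ℕP.m∸n+n≡m i≤N) x≤)) (shift-perm-≤ (N ∸ i) α-perm)

  ∈-singletons⁻ : ∀ {k N w} → w ∈ singletons k N → Valid (suc k) (suc N) w
  ∈-singletons⁻ {suc k} {zero} (here refl) = valid-[1]

  ∈-joins⁻ : ∀ {f k N i w} → w ∈ joins f k N i →
    ∃₂ λ α β → T (odd i) × α ∈ enum f k i × β ∈ enum f (suc k) (N ∸ i) × w ≡ join (N ∸ i) (suc N) α β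
  ∈-joins⁻ {f} {k} {N} {i} w∈ with ∈-cartesianProductWith⁻ (join (N ∸ i) (suc N)) _ _ w∈
  ... | α , β , α∈ , β∈ , refl = α , β , proj₁ (∈-oddOnly⁻ i α∈) , proj₂ (∈-oddOnly⁻ i α∈) , β∈ , refl

  ∈-joins⁺ : ∀ {f k m i α β} → T (odd i) → α ∈ enum f k i → β ∈ enum f (suc k) m →
    join m (suc (m + i)) α β ∈ joins f k (m + i) i
  ∈-joins⁺ {f} {k} {m} {i} odd-i α∈ β∈ rewrite ℕP.m+n∸n≡m m i =
    ∈-cartesianProductWith⁺ (join m (suc (m + i))) (∈-oddOnly⁺ {i = i} odd-i α∈) β∈

  enum-sound : ∀ {f k n w} → n ≤ f → w ∈ enum f k n → Valid k n w
  enum-sound {_} {suc k} {zero} _ (here refl) = valid-[]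
  enum-sound {suc f} {suc k} {suc N} (s≤s N≤f) w∈ with ∈-++⁻ (singletons k N) w∈
  ... | inj₁ w∈singletons = ∈-singletons⁻ w∈singletons
  ... | inj₂ w∈joins with ∈-concatTo⁻ N w∈joins
  ... | i , i≤N , w∈ with ∈-joins⁻ {f} {k} {N} {i} w∈
  ... | α , β , odd-i , α∈ , β∈ , refl =
    subst (λ n → Valid (suc k) (suc n) (join (N ∸ i) (suc n) α β)) (ℕP.m∸n+n≡m i≤N)
      (valid-join odd-i (enum-sound (ℕP.≤-trans i≤N N≤f) α∈)
                        (enum-sound (ℕP.≤-trans (ℕP.m∸n≤m N i) N≤f) β∈))

  enum-complete : ∀ {f k n w} → n ≤ f → Valid k n w → w ∈ enum f k n
  enum-complete {k = zero} _ valid = ⊥-elim (¬valid-0 valid)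
  enum-complete {k = suc k} {zero} _ valid rewrite ↭-empty-inv (Valid.perm valid) = here refl
  enum-complete {suc f} {suc k} {suc N} (s≤s N≤f) valid with decompose valid
  ... | singleton = here refl
  ... | joined {i = i} {m} odd-i α-valid β-valid =
    ∈-++⁺ʳ (singletons k (m + i)) (∈-concatTo⁺ (ℕP.m≤n+m i m)
      (∈-joins⁺ {f} {k} {m} {i} odd-i (enum-complete (ℕP.≤-trans (ℕP.m≤n+m i m) N≤f) α-valid)
                      (enum-complete (ℕP.≤-trans (ℕP.m≤m+n m i) N≤f) β-valid)))

  enum⇔valid : ∀ {f k n w} → n ≤ f → w ∈ enum f k n ⇔ Valid k n w
  enum⇔valid n≤f = mk⇔ (enum-sound n≤f) (enum-complete n≤f)

  singletons-disjoint : ∀ {f k N} → Disjoint (singletons k N) (concatTo N (joins f k N))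
  singletons-disjoint {f} {suc k} {zero} (here refl , w∈) with ∈-joins⁻ {f} {suc k} {0} {0} w∈
  ... | _ , _ , () , _
  singletons-disjoint {k = zero} (() , _)
  singletons-disjoint {k = suc k} {suc N} (() , _)

  enum-unique : ∀ {f k n} → n ≤ f → Unique (enum f k n)
  enum-unique {k = zero} _ = []
  enum-unique {k = suc k} {zero} _ = [] ∷ []
  enum-unique {suc f} {suc k} {suc N} (s≤s N≤f) =
    UniqueP.++⁺ (singletons-unique k N) (concatTo-unique N joins-unique joins-disjoint) (singletons-disjoint {f} {k} {N})
    where
    singletons-unique : ∀ k N → Unique (singletons k N)
    singletons-unique (suc k) zero = [] ∷ []
    singletons-unique zero _ = []
    singletons-unique (suc k) (suc N) = []
    joins-member : ∀ {i w} → i ≤ N → w ∈ joins f k N i →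
      ∃₂ λ α β → IsPerm i α × w ≡ join (N ∸ i) (suc N) α β × All (_< suc N) (shift (N ∸ i) α)
    joins-member {i} i≤N w∈ with ∈-joins⁻ {f} {k} {N} {i} w∈
    ... | α , β , _ , α∈ , _ , refl = α , β , α-perm , refl , shift-perm-< i≤N α-perm
      where
      α-perm : IsPerm _ α
      α-perm = Valid.perm (enum-sound {k = k} (ℕP.≤-trans i≤N N≤f) α∈)
    joins-unique : ∀ {i} → i ≤ N → Unique (joins f k N i)
    joins-unique {i} i≤N = cartesianProductWith-unique {P = IsPerm i} (join (N ∸ i) (suc N)) join-injective
      (All.tabulate (λ α∈ → Valid.perm (enum-sound {k = k} (ℕP.≤-trans i≤N N≤f) (proj₂ (∈-oddOnly⁻ i α∈)))))
      (oddOnly-unique i (enum-unique {k = k} (ℕP.≤-trans i≤N N≤f)))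
      (enum-unique {k = suc k} (ℕP.≤-trans (ℕP.m∸n≤m N i) N≤f))
      where
      join-injective : ∀ {α α′ β β′} → IsPerm i α → IsPerm i α′ →
        join (N ∸ i) (suc N) α β ≡ join (N ∸ i) (suc N) α′ β′ → α ≡ α′ × β ≡ β′
      join-injective α-perm α′-perm eq with split-at-maximum (shift-perm-< i≤N α-perm) (shift-perm-< i≤N α′-perm) eq
      ... | shifts≡ , β≡β′ = ListP.map-injective (ℕP.+-cancelˡ-≡ (N ∸ i) _ _) shifts≡ , β≡β′
    joins-disjoint : ∀ {i j} → i < j → j ≤ N → Disjoint (joins f k N i) (joins f k N j)
    joins-disjoint {i} {j} i<j j≤N (w∈i , w∈j)
      with joins-member (ℕP.<⇒≤ (ℕP.<-≤-trans i<j j≤N)) w∈i | joins-member j≤N w∈j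
    ... | α , β , α-perm , refl , α< | α′ , β′ , α′-perm , eq , α′< =
      ℕP.<-irrefl (trans (sym (length-shift α-perm)) (trans (cong length shifts≡) (length-shift α′-perm))) i<j
      where
      shifts≡ : shift (N ∸ i) α ≡ shift (N ∸ j) α′
      shifts≡ = proj₁ (split-at-maximum α< α′< eq)
      length-shift : ∀ {m l α} → IsPerm l α → length (shift m α) ≡ l
      length-shift {m} {α = α} α-perm = trans (ListP.length-map (m +_) α) (perm-length α-perm)

module Counting where

  open PowerSeries
  open Permutations
    using (counted⇔valid; join; concatTo; oddOnly; singletons; enum; joins; enum-unique; enum⇔valid; length-unique)
  open import Data.Nat as ℕ using (ℕ; zero; suc; _∸_; _≤_)
  import Data.Nat.Properties as ℕP
  open import Data.Integer using (+_; 0ℤ; _+_; _*_)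
  import Data.Integer.Properties as ℤP
  open import Data.Bool using (true; false)
  open import Data.List using (List; []; _∷_; _++_; length; map; cartesianProductWith)
  import Data.List.Properties as ListP
  open import Data.Product using (_,_)
  open import Function.Construct.Composition using (_⇔-∘_)
  open import Function.Construct.Symmetry using (⇔-sym)
  open import Relation.Binary.PropositionalEquality using (_≡_; _≗_; refl; sym; trans; cong; cong₂; module ≡-Reasoning)
  open ≡-Reasoning

  count : ℕ → ℕ → ℕ
  count k n = length (enum n k n)

  length-enum : ∀ {f} k {n} → n ≤ f → length (enum f k n) ≡ count k n
  length-enum k n≤f = length-unique (enum-unique {k = k} n≤f) (enum-unique {k = k} ℕP.≤-refl)
    (λ w → ⇔-sym (enum⇔valid {k = k} ℕP.≤-refl) ⇔-∘ enum⇔valid n≤f)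

  isCount⇒count : ∀ {k n c} → IsCount k n c → c ≡ count k n
  isCount⇒count {k} (L , len , L! , L⇔) = trans (sym len) (length-unique L! (enum-unique {k = k} ℕP.≤-refl)
    (λ w → ⇔-sym (enum⇔valid ℕP.≤-refl) ⇔-∘ (counted⇔valid {k} ⇔-∘ L⇔ w)))

  length-concatTo : ∀ {A : Set} n (g : ℕ → List A) → + length (concatTo n g) ≡ sumTo n (λ i → + length (g i))
  length-concatTo zero g = refl
  length-concatTo (suc n) g = begin
    + length (concatTo n g ++ g (suc n))                  ≡⟨ cong +_ (ListP.length-++ (concatTo n g)) ⟩
    + (length (concatTo n g) ℕ.+ length (g (suc n)))       ≡⟨ ℤP.pos-+ (length (concatTo n g)) _ ⟩
    + length (concatTo n g) + + length (g (suc n))         ≡⟨ cong (_+ + length (g (suc n))) (length-concatTo n g) ⟩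
    sumTo n (λ i → + length (g i)) + + length (g (suc n)) ∎

  length-cartesianProductWith : ∀ {A B C : Set} (f : A → B → C) xs ys →
    length (cartesianProductWith f xs ys) ≡ length xs ℕ.* length ys
  length-cartesianProductWith f [] ys = refl
  length-cartesianProductWith f (x ∷ xs) ys = begin
    length (map (f x) ys ++ cartesianProductWith f xs ys)            ≡⟨ ListP.length-++ (map (f x) ys) ⟩
    length (map (f x) ys) ℕ.+ length (cartesianProductWith f xs ys)  ≡⟨ cong₂ ℕ._+_ (ListP.length-map (f x) ys)
                                                                          (length-cartesianProductWith f xs ys) ⟩
    length ys ℕ.+ length xs ℕ.* length ys                            ∎

  C : ℕ → Series
  C k n = + count k n

  length-joins : ∀ {N} k {i} → i ≤ N → + length (joins N k N i) ≡ oddPart (C k) i * C (suc k) (N ∸ i)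
  length-joins {N} k {i} i≤N = begin
    + length (joins N k N i)
      ≡⟨ cong +_ (length-cartesianProductWith (join (N ∸ i) (suc N)) (oddOnly i (enum N k i)) _) ⟩
    + (length (oddOnly i (enum N k i)) ℕ.* length (enum N (suc k) (N ∸ i)))
      ≡⟨ ℤP.pos-* (length (oddOnly i (enum N k i))) _ ⟩
    + length (oddOnly i (enum N k i)) * + length (enum N (suc k) (N ∸ i))
      ≡⟨ cong₂ _*_ odd-factor (cong +_ (length-enum (suc k) (ℕP.m∸n≤m N i))) ⟩
    oddPart (C k) i * C (suc k) (N ∸ i) ∎
    where
    odd-factor : + length (oddOnly i (enum N k i)) ≡ oddPart (C k) i
    odd-factor with odd i
    ... | true = cong +_ (length-enum k i≤N)
    ... | false = refl

  C-suc : ∀ k N → C (suc k) (suc N) ≡ + length (singletons k N) + (oddPart (C k) ⋆ C (suc k)) N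
  C-suc k N = begin
    + length (singletons k N ++ concatTo N (joins N k N))                 ≡⟨ cong +_ (ListP.length-++ (singletons k N)) ⟩
    + (length (singletons k N) ℕ.+ length (concatTo N (joins N k N)))     ≡⟨ ℤP.pos-+ (length (singletons k N)) _ ⟩
    + length (singletons k N) + + length (concatTo N (joins N k N))       ≡⟨ cong (_+_ (+ length (singletons k N))) sums ⟩
    + length (singletons k N) + (oddPart (C k) ⋆ C (suc k)) N             ∎
    where
    sums : + length (concatTo N (joins N k N)) ≡ (oddPart (C k) ⋆ C (suc k)) N
    sums = trans (length-concatTo N (joins N k N)) (sumTo-cong N (λ i i≤N → length-joins k i≤N))

  oddPart-C₁ : oddPart (C 1) ≗ 𝟘
  oddPart-C₁ zero = refl
  oddPart-C₁ (suc N) with odd (suc N)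
  ... | false = refl
  ... | true = trans (C-suc 0 N) (trans (ℤP.+-identityˡ _) (sumTo-zero N vanishes))
    where
    vanishes : ∀ i → oddPart (C 0) i * C 1 (N ∸ i) ≡ 0ℤ
    vanishes i with odd i
    ... | true = refl
    ... | false = refl

  C-recurrence : ∀ t → C (suc (suc t)) ≗ one ⊕ X (one ⊕ oddPart (C (suc t)) ⋆ C (suc (suc t)))
  C-recurrence t zero = refl
  C-recurrence t (suc N) = begin
    C (suc (suc t)) (suc N)                                          ≡⟨ C-suc (suc t) N ⟩
    + length (singletons (suc t) N) + (oddPart (C (suc t)) ⋆ C (suc (suc t))) N
      ≡⟨ cong (_+ (oddPart (C (suc t)) ⋆ C (suc (suc t))) N) (singletons-one N) ⟩
    one N + (oddPart (C (suc t)) ⋆ C (suc (suc t))) N                 ≡⟨ ℤP.+-identityˡ _ ⟨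
    0ℤ + (one N + (oddPart (C (suc t)) ⋆ C (suc (suc t))) N)          ∎
    where
    singletons-one : ∀ N → + length (singletons (suc t) N) ≡ one N
    singletons-one zero = refl
    singletons-one (suc N) = refl

  oddPart-C-recurrence : ∀ t → oddPart (C (suc (suc t))) ≗ X (one ⊕ oddPart (C (suc t)) ⋆ oddPart (C (suc (suc t))))
  oddPart-C-recurrence t n = trans (oddPart-cong (C-recurrence t) n)
    (oddPart-recurrence (C (suc (suc t))) (λ i → sym (oddPart-idem (C (suc t)) i)) n)

  C⋆Uhat : ∀ t → C (suc (suc t)) ⋆ Uhat (suc t) ≗ + 2 · (Uhat t ⊕ X (Uhat t))
  C⋆Uhat t = ⋆Uhat t (C-recurrence t)
    where open Denominators (λ s → oddPart (C (suc s))) oddPart-C₁ oddPart-C-recurrence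

open import Data.Nat using (ℕ; suc; _≤_; _∸_; s≤s)
open import Data.Integer using (+_; _+_; _*_)
open import Function using (_∘_)
open import Relation.Binary.PropositionalEquality using (_≡_; cong; module ≡-Reasoning)
open PowerSeries using (X; ⋆-congˡ; onePlusX≗)
open Counting using (C; isCount⇒count; C⋆Uhat)

corollary2p5 : (k : ℕ) → 2 ≤ k → (a : ℕ → ℕ) → ((n : ℕ) → IsCount k n (a n)) →
    (n : ℕ) → ((λ i → + a i) ⋆ Uhat (k ∸ 1)) n ≡ + 2 * onePlusX (Uhat (k ∸ 2)) n
corollary2p5 (suc (suc t)) (s≤s (s≤s _)) a a-counts n = begin
  ((λ i → + a i) ⋆ Uhat (suc t)) n    ≡⟨ ⋆-congˡ (Uhat (suc t)) (cong +_ ∘ isCount⇒count ∘ a-counts) n ⟩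
  (C (suc (suc t)) ⋆ Uhat (suc t)) n  ≡⟨ C⋆Uhat t n ⟩
  + 2 * (Uhat t n + X (Uhat t) n)     ≡⟨ cong (+ 2 *_) (onePlusX≗ (Uhat t) n) ⟨
  + 2 * onePlusX (Uhat t) n           ∎
  where open ≡-Reasoning
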